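{- For integers $N,n,i,j\ge0$ and $m\in\{1,2\}$, $D^{\mathrm{I}}_{m,3N}(i,j,n)=D^{\mathrm{II}}_{m,3N}(i,j,n)$.
   Context: For a partition into distinct parts $\pi=(\pi_1>\pi_2>\cdots)$, odd-indexed parts are $\pi_1,\pi_3,\dots$ and even-indexed parts are $\pi_2,\pi_4,\dots$. $D^{\mathrm{I}}_{m,3N}(i,j,n)$ is the number of partitions of $n$ into distinct parts such that: (i) each part is $\not\equiv -m\pmod3$; (ii) each part is $\le 3N$; (iii) exactly $i$ odd-indexed parts are $\equiv m\pmod3$; (iv) exactly $j$ even-indexed parts are $\equiv m\pmod3$. $D^{\mathrm{II}}_{m,3N}(i,j,n)$ is the number of partitions of $n$ into distinct parts such that: (i) each part is $\not\equiv-m\pmod3$; (ii) there are exactly $i$ parts $\equiv m\pmod6$, all $\le 6N+m-6$; (iii) there are exactly $j$ parts $\equiv m+3\pmod6$, all $\le 6(N-i)+m-3$; (iv) all parts $\equiv0\pmod3$ are $\le 3(N-i-j)$. -}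

module Defs where

open import Data.Nat using (ℕ; zero; suc; _+_; _*_; _∸_; _%_; _≡ᵇ_; _≤ᵇ_)
open import Data.Bool using (Bool; true; false; _∧_; not; if_then_else_)
open import Data.List using (List; []; _∷_; _++_; map)

-- Partitions of n into distinct parts, all parts ≤ k, each written as a
-- strictly decreasing list of positive integers (π₁ > π₂ > ⋯).
dparts : ℕ → ℕ → List (List ℕ)
dparts zero    zero    = [] ∷ []
dparts zero    (suc n) = []
dparts (suc k) n =
  map (suc k ∷_) (if suc k ≤ᵇ n then dparts k (n ∸ suc k) else [])
  ++ dparts k n

DistinctPartitions : ℕ → List (List ℕ)
DistinctPartitions n = dparts n n

mutual
  oddIndexed : List ℕ → List ℕ
  oddIndexed []       = []
  oddIndexed (x ∷ xs) = x ∷ evenIndexed xs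

  evenIndexed : List ℕ → List ℕ
  evenIndexed []       = []
  evenIndexed (x ∷ xs) = oddIndexed xs

countB : (ℕ → Bool) → List ℕ → ℕ
countB p []       = 0
countB p (x ∷ xs) = if p x then suc (countB p xs) else countB p xs

countL : (List ℕ → Bool) → List (List ℕ) → ℕ
countL p []       = 0
countL p (x ∷ xs) = if p x then suc (countL p xs) else countL p xs

allB : (ℕ → Bool) → List ℕ → Bool
allB p []       = true
allB p (x ∷ xs) = p x ∧ allB p xs

-- p ≢ -m (mod 3), for m ∈ {1,2}: -m ≡ 3 - m (mod 3)
notNegM : ℕ → ℕ → Bool
notNegM m p = not (p % 3 ≡ᵇ (3 ∸ m))

condI : ℕ → ℕ → ℕ → ℕ → List ℕ → Bool
condI m N i j π =
  allB (notNegM m) π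
  ∧ allB (λ p → p ≤ᵇ 3 * N) π
  ∧ (countB (λ p → p % 3 ≡ᵇ m) (oddIndexed π) ≡ᵇ i)
  ∧ (countB (λ p → p % 3 ≡ᵇ m) (evenIndexed π) ≡ᵇ j)

DI : ℕ → ℕ → ℕ → ℕ → ℕ → ℕ
DI m N i j n = countL (condI m N i j) (DistinctPartitions n)

-- Bounds are written additively to avoid truncated subtraction:
--   p ≤ 6N + m - 6          ⇔  p + 6 ≤ 6N + m
--   p ≤ 6(N - i) + m - 3    ⇔  p + 3 ≤ 6(N ∸ i) + m   (for positive p, m ≤ 2;
--                               if i > N the true bound is negative and both sides are false)
--   p ≤ 3(N - i - j)        ⇔  p ≤ 3(N ∸ i ∸ j)       (for positive p, same reason)
condII : ℕ → ℕ → ℕ → ℕ → List ℕ → Bool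
condII m N i j π =
  allB (notNegM m) π
  ∧ (countB (λ p → p % 6 ≡ᵇ m) π ≡ᵇ i)
  ∧ allB (λ p → if p % 6 ≡ᵇ m then p + 6 ≤ᵇ 6 * N + m else true) π
  ∧ (countB (λ p → p % 6 ≡ᵇ (m + 3)) π ≡ᵇ j)
  ∧ allB (λ p → if p % 6 ≡ᵇ (m + 3) then p + 3 ≤ᵇ 6 * (N ∸ i) + m else true) π
  ∧ allB (λ p → if p % 3 ≡ᵇ 0 then p ≤ᵇ 3 * (N ∸ i ∸ j) else true) π

DII : ℕ → ℕ → ℕ → ℕ → ℕ → ℕ
DII m N i j n = countL (condII m N i j) (DistinctPartitions n)

-- Both counts are compared with an explicit series in q, a partition of n having weight qⁿ. In D^II the three
-- classes of parts are chosen independently, so it is q^{e(i,j)} [N; i, j, N−i−j]_{q⁶} (−q³; q³)_{N−i−j} with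
-- e(i, j) the least admissible sum; this is read off by building the partitions block by block over (6L, 6L + 6].
-- In D^I, new largest parts 3N + 1, 3N + 2, 3N + 3 exchange odd and even positions, which gives a recurrence in
-- N. The closed form satisfies the same recurrence: without the factor q^{e(i,j)} it is an identity for the
-- q-multinomial, which follows from its first- and last-letter recurrences once both sides are multiplied by
-- 1 + q^{3r}.

module Submission where

open import Data.Bool using (Bool; true; false; _∧_; not; if_then_else_; T)
open import Data.Bool.Properties using (∧-zeroʳ; ∧-comm)
open import Data.Empty using (⊥-elim)
open import Data.List using (List; []; _∷_; _++_; map)
open import Data.Nat
open import Data.Nat.DivMod using ([m+kn]%n≡m%n)
open import Data.Nat.Induction using (<-rec)
open import Data.Nat.Properties
open import Algebra.Properties.CommutativeSemigroup +-commutativeSemigroup using () renaming (interchange to +-interchange)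
open import Data.Nat.Tactic.RingSolver using (solve-∀)
open import Data.Product using (_,_)
open import Data.Sum using (_⊎_; inj₁; inj₂)
open import Relation.Binary.Bundles using (Setoid)
open import Relation.Binary.PropositionalEquality
import Relation.Binary.Reasoning.Setoid
open import Relation.Nullary using (yes; no)
open import Defs

-- Power series

+-cong₄ : ∀ {a b c d a′ b′ c′ d′ : ℕ} → a ≡ a′ → b ≡ b′ → c ≡ c′ → d ≡ d′ → a + b + c + d ≡ a′ + b′ + c′ + d′
+-cong₄ refl refl refl refl = refl

-- A series f stands for the power series Σₙ f n qⁿ; shift k f is qᵏ · f.
Series : Set
Series = ℕ → ℕ

𝟘 𝟙 : Series
𝟘 _       = 0
𝟙 zero    = 1
𝟙 (suc _) = 0

infixl 6 _⊕_
_⊕_ : Series → Series → Series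
(f ⊕ g) n = f n + g n

shift : ℕ → Series → Series
shift zero    f n       = f n
shift (suc k) f zero    = 0
shift (suc k) f (suc n) = shift k f n

shift-cong : ∀ k {f g} → f ≗ g → shift k f ≗ shift k g
shift-cong zero    f≗g n       = f≗g n
shift-cong (suc k) f≗g zero    = refl
shift-cong (suc k) f≗g (suc n) = shift-cong k f≗g n

shift-𝟘 : ∀ k → shift k 𝟘 ≗ 𝟘
shift-𝟘 zero    n       = refl
shift-𝟘 (suc k) zero    = refl
shift-𝟘 (suc k) (suc n) = shift-𝟘 k n

shift-vanishes : ∀ k {f} → f ≗ 𝟘 → shift k f ≗ 𝟘
shift-vanishes k f≗𝟘 n = trans (shift-cong k f≗𝟘 n) (shift-𝟘 k n)

shift-⊕ : ∀ k f g → shift k (f ⊕ g) ≗ shift k f ⊕ shift k g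
shift-⊕ zero    f g n       = refl
shift-⊕ (suc k) f g zero    = refl
shift-⊕ (suc k) f g (suc n) = shift-⊕ k f g n

shift-⊕₄ : ∀ k f₁ f₂ f₃ f₄ → shift k (f₁ ⊕ f₂ ⊕ f₃ ⊕ f₄) ≗ shift k f₁ ⊕ shift k f₂ ⊕ shift k f₃ ⊕ shift k f₄
shift-⊕₄ k f₁ f₂ f₃ f₄ n =
  trans (shift-⊕ k (f₁ ⊕ f₂ ⊕ f₃) f₄ n)
    (cong (_+ shift k f₄ n) (trans (shift-⊕ k (f₁ ⊕ f₂) f₃ n) (cong (_+ shift k f₃ n) (shift-⊕ k f₁ f₂ n))))

shift-+ : ∀ a b f → shift (a + b) f ≗ shift a (shift b f)
shift-+ zero    b f n       = refl
shift-+ (suc a) b f zero    = refl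
shift-+ (suc a) b f (suc n) = shift-+ a b f n

shift-shift : ∀ a b {c} f → a + b ≡ c → shift a (shift b f) ≗ shift c f
shift-shift a b f refl n = sym (shift-+ a b f n)

shift-regroup : ∀ a b c d f → a + b ≡ c + d → shift a (shift b f) ≗ shift c (shift d f)
shift-regroup a b c d f eq n = trans (shift-shift a b f eq n) (sym (shift-shift c d f refl n))

shift-comm : ∀ a b f → shift a (shift b f) ≗ shift b (shift a f)
shift-comm a b f n = trans (shift-shift a b f refl n) (sym (shift-shift b a f (+-comm b a) n))

shift-below : ∀ k f {n} → n < k → shift k f n ≡ 0
shift-below (suc k) f {zero}  _         = refl
shift-below (suc k) f {suc n} (s≤s n<k) = shift-below k f n<k

shift-agrees-below : ∀ k {f g} n → (∀ x → x < n → f x ≡ g x) → shift (suc k) f n ≡ shift (suc k) g n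
shift-agrees-below k       zero    _  = refl
shift-agrees-below zero    (suc n) eq = eq n ≤-refl
shift-agrees-below (suc k) (suc n) eq = shift-agrees-below k n (λ x x<n → eq x (m<n⇒m<1+n x<n))

-- Multiplication by 1 + qᵏ is injective: the coefficient of qⁿ in qᵏ · f only involves earlier coefficients when k > 0.
⊕shift-injective : ∀ k {f g} → f ⊕ shift k f ≗ g ⊕ shift k g → f ≗ g
⊕shift-injective zero {f} {g} eq n =
  *-cancelˡ-≡ (f n) (g n) 2 (trans (double (f n)) (trans (eq n) (sym (double (g n)))))
  where
  double : ∀ a → 2 * a ≡ a + a
  double = solve-∀
⊕shift-injective (suc k) {f} {g} eq = <-rec (λ n → f n ≡ g n) step
  where
  step : ∀ n → (∀ {x} → x < n → f x ≡ g x) → f n ≡ g n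
  step n below = +-cancelʳ-≡ (shift (suc k) f n) (f n) (g n)
    (trans (eq n) (cong (g n +_) (sym (shift-agrees-below k n (λ x → below)))))

Fam₃ : Set
Fam₃ = ℕ → ℕ → ℕ → Series

base : Fam₃
base zero    zero    zero    = 𝟙
base zero    zero    (suc r) = 𝟘
base zero    (suc j) r       = 𝟘
base (suc i) j       r       = 𝟘

base-sucʲ : ∀ i j r → base i (suc j) r ≗ 𝟘
base-sucʲ zero    j r n = refl
base-sucʲ (suc i) j r n = refl

-- The q-multinomial series

-- G i j r = [i+j+r; i, j, r]_{q⁶} · (−q³; q³)_r, through the recurrence that removes the first
-- letter of a word with i letters a, j letters b and r letters c.
mutual
  G : Fam₃
  G i j r = base i j r ⊕ Gᵢ i j r ⊕ Gⱼ i j r ⊕ Gᵣ i j r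

  Gᵢ Gⱼ Gᵣ : Fam₃
  Gᵢ zero    j r = 𝟘
  Gᵢ (suc i) j r = shift (6 * (j + r)) (G i j r)
  Gⱼ i zero    r = 𝟘
  Gⱼ i (suc j) r = shift (6 * r) (G i j r)
  Gᵣ i j zero    = 𝟘
  Gᵣ i j (suc r) = G i j r ⊕ shift (3 * suc r) (G i j r)

G-sucʲ : ∀ i j r → G i (suc j) r ≗ Gᵢ i (suc j) r ⊕ Gⱼ i (suc j) r ⊕ Gᵣ i (suc j) r
G-sucʲ i j r n = cong (λ b → b + Gᵢ i (suc j) r n + Gⱼ i (suc j) r n + Gᵣ i (suc j) r n) (base-sucʲ i j r n)

mutual
  pascal : ∀ i j r →
    shift (6 * suc j) (G i (suc j) r) ⊕ G (suc i) j r ≗ G i (suc j) r ⊕ shift (6 * suc i) (G (suc i) j r)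
  pascal i j r n = begin
    shift s (G i (suc j) r) n + (Y₁ n + Y₂ n + Y₃ n)
      ≡⟨ cong (_+ (Y₁ n + Y₂ n + Y₃ n)) (shift-cong s (G-sucʲ i j r) n) ⟩
    shift s (X₁ ⊕ X₂ ⊕ X₃) n + (Y₁ n + Y₂ n + Y₃ n)
      ≡⟨ cong (_+ (Y₁ n + Y₂ n + Y₃ n)) (shift-⊕ s (X₁ ⊕ X₂) X₃ n) ⟩
    shift s (X₁ ⊕ X₂) n + shift s X₃ n + (Y₁ n + Y₂ n + Y₃ n)
      ≡⟨ interchange (shift s (X₁ ⊕ X₂) n) (shift s X₃ n) (Y₁ n) (Y₂ n) (Y₃ n) ⟩
    (shift s (X₁ ⊕ X₂) n + (Y₁ n + Y₂ n)) + (shift s X₃ n + Y₃ n)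
      ≡⟨ cong₂ _+_ (cong₂ _+_ (pascalᵢ i j r n) (pascalⱼ i j r n)) (pascalᵣ i j r n) ⟩
    (X₁ n + shift s′ Y₁ n) + (X₂ n + shift s′ Y₂ n) + (X₃ n + shift s′ Y₃ n)
      ≡⟨ regroup (X₁ n) (X₂ n) (X₃ n) (shift s′ Y₁ n) (shift s′ Y₂ n) (shift s′ Y₃ n) ⟩
    X₁ n + X₂ n + X₃ n + (shift s′ Y₁ n + shift s′ Y₂ n + shift s′ Y₃ n)
      ≡⟨ cong (X₁ n + X₂ n + X₃ n +_) (sym (trans (shift-⊕ s′ (Y₁ ⊕ Y₂) Y₃ n)
                                                  (cong (_+ shift s′ Y₃ n) (shift-⊕ s′ Y₁ Y₂ n)))) ⟩
    X₁ n + X₂ n + X₃ n + shift s′ (Y₁ ⊕ Y₂ ⊕ Y₃) n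
      ≡⟨ cong (_+ shift s′ (Y₁ ⊕ Y₂ ⊕ Y₃) n) (sym (G-sucʲ i j r n)) ⟩
    G i (suc j) r n + shift s′ (G (suc i) j r) n
      ∎
    where
    open ≡-Reasoning
    s s′ : ℕ
    s = 6 * suc j
    s′ = 6 * suc i
    X₁ = Gᵢ i (suc j) r
    X₂ = Gⱼ i (suc j) r
    X₃ = Gᵣ i (suc j) r
    Y₁ = Gᵢ (suc i) j r
    Y₂ = Gⱼ (suc i) j r
    Y₃ = Gᵣ (suc i) j r
    interchange : ∀ a b c d e → a + b + (c + d + e) ≡ (a + (c + d)) + (b + e)
    interchange = solve-∀
    regroup : ∀ a b c d e f → (a + d) + (b + e) + (c + f) ≡ a + b + c + (d + e + f)
    regroup = solve-∀

  pascalᵢ : ∀ i j r →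
    shift (6 * suc j) (Gᵢ i (suc j) r ⊕ Gⱼ i (suc j) r) ≗ Gᵢ i (suc j) r ⊕ shift (6 * suc i) (Gᵢ (suc i) j r)
  pascalᵢ zero j r = shift-regroup (6 * suc j) (6 * r) (6 * 1) (6 * (j + r)) (G zero j r) (exponents j r)
    where
    exponents : ∀ j r → 6 * suc j + 6 * r ≡ 6 * 1 + 6 * (j + r)
    exponents = solve-∀
  pascalᵢ (suc i) j r n = begin
    shift s (shift a A ⊕ shift (6 * r) B) n
      ≡⟨ shift-⊕ s (shift a A) (shift (6 * r) B) n ⟩
    shift s (shift a A) n + shift s (shift (6 * r) B) n
      ≡⟨ cong₂ _+_ (shift-comm s a A n) (shift-shift s (6 * r) B (sym (*-distribˡ-+ 6 (suc j) r)) n) ⟩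
    shift a (shift s A) n + shift a B n
      ≡⟨ sym (shift-⊕ a (shift s A) B n) ⟩
    shift a (shift s A ⊕ B) n
      ≡⟨ shift-cong a (pascal i j r) n ⟩
    shift a (A ⊕ shift s′ B) n
      ≡⟨ shift-⊕ a A (shift s′ B) n ⟩
    shift a A n + shift a (shift s′ B) n
      ≡⟨ cong (shift a A n +_) (shift-regroup a s′ (6 * suc (suc i)) (6 * (j + r)) B (exponents i j r) n) ⟩
    shift a A n + shift (6 * suc (suc i)) (shift (6 * (j + r)) B) n
      ∎
    where
    open ≡-Reasoning
    s s′ a : ℕ
    s = 6 * suc j
    s′ = 6 * suc i
    a = 6 * (suc j + r)
    A = G i (suc j) r
    B = G (suc i) j r
    exponents : ∀ i j r → 6 * (suc j + r) + 6 * suc i ≡ 6 * suc (suc i) + 6 * (j + r)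
    exponents = solve-∀

  pascalⱼ : ∀ i j r →
    Gᵢ (suc i) j r ⊕ Gⱼ (suc i) j r ≗ Gⱼ i (suc j) r ⊕ shift (6 * suc i) (Gⱼ (suc i) j r)
  pascalⱼ i zero r n = cong (shift (6 * r) (G i zero r) n +_) (sym (shift-𝟘 (6 * suc i) n))
  pascalⱼ i (suc j) r n = begin
    shift (6 * (suc j + r)) A n + shift (6 * r) B n
      ≡⟨ cong (_+ shift (6 * r) B n) (sym (shift-shift (6 * r) s A (exponents j r) n)) ⟩
    shift (6 * r) (shift s A) n + shift (6 * r) B n
      ≡⟨ sym (shift-⊕ (6 * r) (shift s A) B n) ⟩
    shift (6 * r) (shift s A ⊕ B) n
      ≡⟨ shift-cong (6 * r) (pascal i j r) n ⟩
    shift (6 * r) (A ⊕ shift s′ B) n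
      ≡⟨ shift-⊕ (6 * r) A (shift s′ B) n ⟩
    shift (6 * r) A n + shift (6 * r) (shift s′ B) n
      ≡⟨ cong (shift (6 * r) A n +_) (shift-comm (6 * r) s′ B n) ⟩
    shift (6 * r) A n + shift s′ (shift (6 * r) B) n
      ∎
    where
    open ≡-Reasoning
    s s′ : ℕ
    s = 6 * suc j
    s′ = 6 * suc i
    A = G i (suc j) r
    B = G (suc i) j r
    exponents : ∀ j r → 6 * r + 6 * suc j ≡ 6 * (suc j + r)
    exponents = solve-∀

  pascalᵣ : ∀ i j r →
    shift (6 * suc j) (Gᵣ i (suc j) r) ⊕ Gᵣ (suc i) j r ≗ Gᵣ i (suc j) r ⊕ shift (6 * suc i) (Gᵣ (suc i) j r)
  pascalᵣ i j zero n = trans (cong (_+ 0) (shift-𝟘 (6 * suc j) n)) (sym (shift-𝟘 (6 * suc i) n))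
  pascalᵣ i j (suc r) n = begin
    shift s (A ⊕ shift c A) n + (B n + shift c B n)
      ≡⟨ cong (_+ (B n + shift c B n)) (shift-⊕ s A (shift c A) n) ⟩
    shift s A n + shift s (shift c A) n + (B n + shift c B n)
      ≡⟨ cong (λ x → shift s A n + x + (B n + shift c B n)) (shift-comm s c A n) ⟩
    shift s A n + shift c (shift s A) n + (B n + shift c B n)
      ≡⟨ +-interchange (shift s A n) (shift c (shift s A) n) (B n) (shift c B n) ⟩
    (shift s A n + B n) + (shift c (shift s A) n + shift c B n)
      ≡⟨ cong ((shift s A n + B n) +_) (sym (shift-⊕ c (shift s A) B n)) ⟩
    (shift s A ⊕ B) n + shift c (shift s A ⊕ B) n
      ≡⟨ cong₂ _+_ (pascal i j r n) (shift-cong c (pascal i j r) n) ⟩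
    (A ⊕ shift s′ B) n + shift c (A ⊕ shift s′ B) n
      ≡⟨ cong ((A n + shift s′ B n) +_) (shift-⊕ c A (shift s′ B) n) ⟩
    (A n + shift s′ B n) + (shift c A n + shift c (shift s′ B) n)
      ≡⟨ +-interchange (A n) (shift s′ B n) (shift c A n) (shift c (shift s′ B) n) ⟩
    (A n + shift c A n) + (shift s′ B n + shift c (shift s′ B) n)
      ≡⟨ cong (λ x → (A n + shift c A n) + (shift s′ B n + x)) (shift-comm c s′ B n) ⟩
    (A n + shift c A n) + (shift s′ B n + shift s′ (shift c B) n)
      ≡⟨ cong ((A n + shift c A n) +_) (sym (shift-⊕ s′ B (shift c B) n)) ⟩
    (A n + shift c A n) + shift s′ (B ⊕ shift c B) n
      ∎
    where
    open ≡-Reasoning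
    s s′ c : ℕ
    s = 6 * suc j
    s′ = 6 * suc i
    c = 3 * suc r
    A = G i (suc j) r
    B = G (suc i) j r

infixl 6 _⊞_
_⊞_ : Fam₃ → Fam₃ → Fam₃
(P ⊞ Q) i j r = P i j r ⊕ Q i j r

infix 4 _≋_
_≋_ : Fam₃ → Fam₃ → Set
P ≋ Q = ∀ i j r → P i j r ≗ Q i j r

Linear : (Fam₃ → Fam₃) → Set
Linear O = ∀ P Q → O (P ⊞ Q) ≋ O P ⊞ O Q

linear₄ : ∀ O → Linear O → ∀ P₁ P₂ P₃ P₄ → O (P₁ ⊞ P₂ ⊞ P₃ ⊞ P₄) ≋ O P₁ ⊞ O P₂ ⊞ O P₃ ⊞ O P₄
linear₄ O lin P₁ P₂ P₃ P₄ i j r n =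
  trans (lin (P₁ ⊞ P₂ ⊞ P₃) P₄ i j r n)
    (cong (_+ O P₄ i j r n) (trans (lin (P₁ ⊞ P₂) P₃ i j r n)
      (cong (_+ O P₃ i j r n) (lin P₁ P₂ i j r n))))

Congruent : (Fam₃ → Fam₃) → Set
Congruent O = ∀ {P Q} → P ≋ Q → O P ≋ O Q

-- Each operator lowers one index of a family by one, with the weight of the corresponding term in a
-- recurrence for G: ᶠ removes the first letter of the word, ˡ the last one.
Iᶠ Jᶠ Rᶠ Iˡ Jˡ Rˡ : Fam₃ → Fam₃
Iᶠ P zero    j r = 𝟘
Iᶠ P (suc i) j r = shift (6 * (j + r)) (P i j r)
Jᶠ P i zero    r = 𝟘
Jᶠ P i (suc j) r = shift (6 * r) (P i j r)
Rᶠ P i j zero    = 𝟘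
Rᶠ P i j (suc r) = P i j r ⊕ shift (3 * suc r) (P i j r)
Iˡ P zero    j r = 𝟘
Iˡ P (suc i) j r = P i j r
Jˡ P i zero    r = 𝟘
Jˡ P i (suc j) r = shift (6 * (i + r)) (P i j r)
Rˡ P i j zero    = 𝟘
Rˡ P i j (suc r) = shift (6 * i) (Rᶠ P i j (suc r))

G-first : G ≋ base ⊞ Iᶠ G ⊞ Jᶠ G ⊞ Rᶠ G
G-first zero    zero    zero    n = refl
G-first zero    zero    (suc r) n = refl
G-first zero    (suc j) zero    n = refl
G-first zero    (suc j) (suc r) n = refl
G-first (suc i) zero    zero    n = refl
G-first (suc i) zero    (suc r) n = refl
G-first (suc i) (suc j) zero    n = refl
G-first (suc i) (suc j) (suc r) n = refl

Iᶠ-linear : Linear Iᶠ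
Iᶠ-linear P Q zero    j r n = refl
Iᶠ-linear P Q (suc i) j r   = shift-⊕ (6 * (j + r)) (P i j r) (Q i j r)

Jᶠ-linear : Linear Jᶠ
Jᶠ-linear P Q i zero    r n = refl
Jᶠ-linear P Q i (suc j) r   = shift-⊕ (6 * r) (P i j r) (Q i j r)

Rᶠ-linear : Linear Rᶠ
Rᶠ-linear P Q i j zero    n = refl
Rᶠ-linear P Q i j (suc r) n =
  trans (cong (P i j r n + Q i j r n +_) (shift-⊕ (3 * suc r) (P i j r) (Q i j r) n))
        (+-interchange (P i j r n) (Q i j r n) (shift (3 * suc r) (P i j r) n) (shift (3 * suc r) (Q i j r) n))

Iˡ-linear : Linear Iˡ
Iˡ-linear P Q zero    j r n = refl
Iˡ-linear P Q (suc i) j r n = refl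

Jˡ-linear : Linear Jˡ
Jˡ-linear P Q i zero    r n = refl
Jˡ-linear P Q i (suc j) r   = shift-⊕ (6 * (i + r)) (P i j r) (Q i j r)

Rˡ-linear : Linear Rˡ
Rˡ-linear P Q i j zero    n = refl
Rˡ-linear P Q i j (suc r) n =
  trans (shift-cong (6 * i) (Rᶠ-linear P Q i j (suc r)) n)
        (shift-⊕ (6 * i) (Rᶠ P i j (suc r)) (Rᶠ Q i j (suc r)) n)

Iˡ-cong : Congruent Iˡ
Iˡ-cong P≋Q zero    j r n = refl
Iˡ-cong P≋Q (suc i) j r   = P≋Q i j r

Jˡ-cong : Congruent Jˡ
Jˡ-cong P≋Q i zero    r n = refl
Jˡ-cong P≋Q i (suc j) r   = shift-cong (6 * (i + r)) (P≋Q i j r)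

Rˡ-cong : Congruent Rˡ
Rˡ-cong P≋Q i j zero    n = refl
Rˡ-cong P≋Q i j (suc r)   =
  shift-cong (6 * i) (λ n → cong₂ _+_ (P≋Q i j r n) (shift-cong (3 * suc r) (P≋Q i j r) n))

-- The operators of the two recurrences commute, except that Jᶠ Rˡ and Rᶠ Jˡ trade places with Jˡ Rᶠ and Rˡ Jᶠ.
Iᶠ-Iˡ : ∀ P → Iᶠ (Iˡ P) ≋ Iˡ (Iᶠ P)
Iᶠ-Iˡ P zero          j r n = refl
Iᶠ-Iˡ P (suc zero)    j r   = shift-𝟘 (6 * (j + r))
Iᶠ-Iˡ P (suc (suc i)) j r n = refl

Iᶠ-Jˡ : ∀ P → Iᶠ (Jˡ P) ≋ Jˡ (Iᶠ P)
Iᶠ-Jˡ P zero    zero    r n = refl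
Iᶠ-Jˡ P zero    (suc j) r n = sym (shift-𝟘 (6 * r) n)
Iᶠ-Jˡ P (suc i) zero    r   = shift-𝟘 (6 * r)
Iᶠ-Jˡ P (suc i) (suc j) r   =
  shift-regroup (6 * (suc j + r)) (6 * (i + r)) (6 * (suc i + r)) (6 * (j + r)) (P i j r) (exponents i j r)
  where
  exponents : ∀ i j r → 6 * (suc j + r) + 6 * (i + r) ≡ 6 * (suc i + r) + 6 * (j + r)
  exponents = solve-∀

Iᶠ-Rˡ : ∀ P → Iᶠ (Rˡ P) ≋ Rˡ (Iᶠ P)
Iᶠ-Rˡ P zero    j zero    n = refl
Iᶠ-Rˡ P zero    j (suc r) n = sym (shift-𝟘 (3 * suc r) n)
Iᶠ-Rˡ P (suc i) j zero      = shift-𝟘 (6 * (j + 0))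
Iᶠ-Rˡ P (suc i) j (suc r) n = begin
  shift (6 * (j + suc r)) (shift (6 * i) (Rᶠ P i j (suc r))) n
    ≡⟨ shift-regroup (6 * (j + suc r)) (6 * i) (6 * suc i) (6 * (j + r)) _ (exponents i j r) n ⟩
  shift (6 * suc i) (shift (6 * (j + r)) (Rᶠ P i j (suc r))) n
    ≡⟨ shift-cong (6 * suc i) (λ x → trans (shift-⊕ (6 * (j + r)) Q (shift c Q) x)
                                           (cong (shift (6 * (j + r)) Q x +_) (shift-comm (6 * (j + r)) c Q x))) n ⟩
  Rˡ (Iᶠ P) (suc i) j (suc r) n
    ∎
  where
  open ≡-Reasoning
  Q = P i j r
  c = 3 * suc r
  exponents : ∀ i j r → 6 * (j + suc r) + 6 * i ≡ 6 * suc i + 6 * (j + r)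
  exponents = solve-∀

Jᶠ-Iˡ : ∀ P → Jᶠ (Iˡ P) ≋ Iˡ (Jᶠ P)
Jᶠ-Iˡ P zero    zero    r n = refl
Jᶠ-Iˡ P zero    (suc j) r   = shift-𝟘 (6 * r)
Jᶠ-Iˡ P (suc i) zero    r n = refl
Jᶠ-Iˡ P (suc i) (suc j) r n = refl

Jᶠ-Jˡ : ∀ P → Jᶠ (Jˡ P) ≋ Jˡ (Jᶠ P)
Jᶠ-Jˡ P i zero          r n = refl
Jᶠ-Jˡ P i (suc zero)    r n = trans (shift-𝟘 (6 * r) n) (sym (shift-𝟘 (6 * (i + r)) n))
Jᶠ-Jˡ P i (suc (suc j)) r   = shift-comm (6 * r) (6 * (i + r)) (P i j r)

Jᶠ-Rˡ : ∀ P → Jᶠ (Rˡ P) ≋ Jˡ (Rᶠ P)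
Jᶠ-Rˡ P i zero    r       n = refl
Jᶠ-Rˡ P i (suc j) zero    n = sym (shift-𝟘 (6 * (i + 0)) n)
Jᶠ-Rˡ P i (suc j) (suc r)   = shift-shift (6 * suc r) (6 * i) (Rᶠ P i j (suc r)) (exponents i r)
  where
  exponents : ∀ i r → 6 * suc r + 6 * i ≡ 6 * (i + suc r)
  exponents = solve-∀

Rᶠ-Iˡ : ∀ P → Rᶠ (Iˡ P) ≋ Iˡ (Rᶠ P)
Rᶠ-Iˡ P zero    j zero    n = refl
Rᶠ-Iˡ P zero    j (suc r)   = shift-𝟘 (3 * suc r)
Rᶠ-Iˡ P (suc i) j zero    n = refl
Rᶠ-Iˡ P (suc i) j (suc r) n = refl

Rᶠ-Jˡ : ∀ P → Rᶠ (Jˡ P) ≋ Rˡ (Jᶠ P)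
Rᶠ-Jˡ P i j       zero    n = refl
Rᶠ-Jˡ P i zero    (suc r) n =
  trans (shift-𝟘 (3 * suc r) n) (sym (shift-vanishes (6 * i) (shift-𝟘 (3 * suc r)) n))
Rᶠ-Jˡ P i (suc j) (suc r) n = sym (begin
  shift (6 * i) (shift (6 * r) Q ⊕ shift c (shift (6 * r) Q)) n
    ≡⟨ shift-⊕ (6 * i) (shift (6 * r) Q) (shift c (shift (6 * r) Q)) n ⟩
  shift (6 * i) (shift (6 * r) Q) n + shift (6 * i) (shift c (shift (6 * r) Q)) n
    ≡⟨ cong (shift (6 * i) (shift (6 * r) Q) n +_) (shift-comm (6 * i) c (shift (6 * r) Q) n) ⟩
  shift (6 * i) (shift (6 * r) Q) n + shift c (shift (6 * i) (shift (6 * r) Q)) n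
    ≡⟨ cong₂ _+_ (shift-shift (6 * i) (6 * r) Q ir n)
                 (shift-cong c (shift-shift (6 * i) (6 * r) Q ir) n) ⟩
  shift (6 * (i + r)) Q n + shift c (shift (6 * (i + r)) Q) n
    ∎)
  where
  open ≡-Reasoning
  Q = P i j r
  c = 3 * suc r
  ir = sym (*-distribˡ-+ 6 i r)

Rᶠ-Rˡ : ∀ P → Rᶠ (Rˡ P) ≋ Rˡ (Rᶠ P)
Rᶠ-Rˡ P i j zero          n = refl
Rᶠ-Rˡ P i j (suc zero)    n =
  trans (shift-𝟘 3 n) (sym (shift-vanishes (6 * i) (shift-𝟘 3) n))
Rᶠ-Rˡ P i j (suc (suc r)) n = sym (trans (shift-⊕ (6 * i) Q (shift c Q) n)
                                        (cong (shift (6 * i) Q n +_) (shift-comm (6 * i) c Q n)))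
  where
  Q = Rᶠ P i j (suc r)
  c = 3 * suc (suc r)

Iᶠ-base : Iᶠ base ≋ Iˡ base
Iᶠ-base zero          j       r       n = refl
Iᶠ-base (suc zero)    zero    zero    n = refl
Iᶠ-base (suc zero)    zero    (suc r)   = shift-𝟘 (6 * suc r)
Iᶠ-base (suc zero)    (suc j) r         = shift-𝟘 (6 * (suc j + r))
Iᶠ-base (suc (suc i)) j       r         = shift-𝟘 (6 * (j + r))

Jᶠ-base : Jᶠ base ≋ Jˡ base
Jᶠ-base i       zero          r       n = refl
Jᶠ-base zero    (suc zero)    zero    n = refl
Jᶠ-base zero    (suc zero)    (suc r) n = trans (shift-𝟘 (6 * suc r) n) (sym (shift-𝟘 (6 * suc r) n))
Jᶠ-base (suc i) (suc zero)    r       n = trans (shift-𝟘 (6 * r) n) (sym (shift-𝟘 (6 * (suc i + r)) n))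
Jᶠ-base i       (suc (suc j)) r       n =
  trans (shift-vanishes (6 * r) (base-sucʲ i j r) n) (sym (shift-vanishes (6 * (i + r)) (base-sucʲ i j r) n))

Rᶠ-base : Rᶠ base ≋ Rˡ base
Rᶠ-base i       j       zero    n = refl
Rᶠ-base zero    zero    (suc r) n = refl
Rᶠ-base zero    (suc j) (suc r) n = refl
Rᶠ-base (suc i) j       (suc r) n =
  trans (shift-𝟘 (3 * suc r) n) (sym (shift-vanishes (6 * suc i) (shift-𝟘 (3 * suc r)) n))

Hˡ : Fam₃
Hˡ = base ⊞ Iˡ G ⊞ Jˡ G ⊞ Rˡ G

Iᶠ-Hˡ : Iᶠ Hˡ ≋ Iˡ base ⊞ Iˡ (Iᶠ G) ⊞ Jˡ (Iᶠ G) ⊞ Rˡ (Iᶠ G)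
Iᶠ-Hˡ i j r n = trans (linear₄ Iᶠ Iᶠ-linear base (Iˡ G) (Jˡ G) (Rˡ G) i j r n)
  (+-cong₄ (Iᶠ-base i j r n) (Iᶠ-Iˡ G i j r n) (Iᶠ-Jˡ G i j r n) (Iᶠ-Rˡ G i j r n))

Jᶠ-Hˡ : Jᶠ Hˡ ≋ Jˡ base ⊞ Iˡ (Jᶠ G) ⊞ Jˡ (Jᶠ G) ⊞ Jˡ (Rᶠ G)
Jᶠ-Hˡ i j r n = trans (linear₄ Jᶠ Jᶠ-linear base (Iˡ G) (Jˡ G) (Rˡ G) i j r n)
  (+-cong₄ (Jᶠ-base i j r n) (Jᶠ-Iˡ G i j r n) (Jᶠ-Jˡ G i j r n) (Jᶠ-Rˡ G i j r n))

Rᶠ-Hˡ : Rᶠ Hˡ ≋ Rˡ base ⊞ Iˡ (Rᶠ G) ⊞ Rˡ (Jᶠ G) ⊞ Rˡ (Rᶠ G)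
Rᶠ-Hˡ i j r n = trans (linear₄ Rᶠ Rᶠ-linear base (Iˡ G) (Jˡ G) (Rˡ G) i j r n)
  (+-cong₄ (Rᶠ-base i j r n) (Rᶠ-Iˡ G i j r n) (Rᶠ-Jˡ G i j r n) (Rᶠ-Rˡ G i j r n))

expandˡ : ∀ O → Congruent O → Linear O → O G ≋ O base ⊞ O (Iᶠ G) ⊞ O (Jᶠ G) ⊞ O (Rᶠ G)
expandˡ O O-cong O-linear i j r n =
  trans (O-cong G-first i j r n) (linear₄ O O-linear base (Iᶠ G) (Jᶠ G) (Rᶠ G) i j r n)

mutual
  G-last : G ≋ base ⊞ Iˡ G ⊞ Jˡ G ⊞ Rˡ G
  G-last i j r n = begin
    G i j r n
      ≡⟨ +-cong₄ refl (Gᵢ-last i j r n) (Gⱼ-last i j r n) (Gᵣ-last i j r n) ⟩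
    (base ⊞ Iᶠ Hˡ ⊞ Jᶠ Hˡ ⊞ Rᶠ Hˡ) i j r n
      ≡⟨ +-cong₄ refl (Iᶠ-Hˡ i j r n) (Jᶠ-Hˡ i j r n) (Rᶠ-Hˡ i j r n) ⟩
    (base ⊞ (Iˡ base ⊞ Iˡ (Iᶠ G) ⊞ Jˡ (Iᶠ G) ⊞ Rˡ (Iᶠ G))
          ⊞ (Jˡ base ⊞ Iˡ (Jᶠ G) ⊞ Jˡ (Jᶠ G) ⊞ Jˡ (Rᶠ G))
          ⊞ (Rˡ base ⊞ Iˡ (Rᶠ G) ⊞ Rˡ (Jᶠ G) ⊞ Rˡ (Rᶠ G))) i j r n
      ≡⟨ regroup (at base) (at (Iˡ base)) (at (Iˡ (Iᶠ G))) (at (Iˡ (Jᶠ G))) (at (Iˡ (Rᶠ G)))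
                 (at (Jˡ base)) (at (Jˡ (Iᶠ G))) (at (Jˡ (Jᶠ G))) (at (Jˡ (Rᶠ G)))
                 (at (Rˡ base)) (at (Rˡ (Iᶠ G))) (at (Rˡ (Jᶠ G))) (at (Rˡ (Rᶠ G))) ⟩
    (base ⊞ (Iˡ base ⊞ Iˡ (Iᶠ G) ⊞ Iˡ (Jᶠ G) ⊞ Iˡ (Rᶠ G))
          ⊞ (Jˡ base ⊞ Jˡ (Iᶠ G) ⊞ Jˡ (Jᶠ G) ⊞ Jˡ (Rᶠ G))
          ⊞ (Rˡ base ⊞ Rˡ (Iᶠ G) ⊞ Rˡ (Jᶠ G) ⊞ Rˡ (Rᶠ G))) i j r n
      ≡⟨ sym (+-cong₄ refl (expandˡ Iˡ Iˡ-cong Iˡ-linear i j r n) (expandˡ Jˡ Jˡ-cong Jˡ-linear i j r n)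
                           (expandˡ Rˡ Rˡ-cong Rˡ-linear i j r n)) ⟩
    (base ⊞ Iˡ G ⊞ Jˡ G ⊞ Rˡ G) i j r n
      ∎
    where
    open ≡-Reasoning
    at : Fam₃ → ℕ
    at P = P i j r n
    regroup : ∀ b i₀ ii ij ir j₀ ji jj jr r₀ ri rj rr →
      b + (i₀ + ii + ji + ri) + (j₀ + ij + jj + jr) + (r₀ + ir + rj + rr) ≡
      b + (i₀ + ii + ij + ir) + (j₀ + ji + jj + jr) + (r₀ + ri + rj + rr)
    regroup = solve-∀

  Gᵢ-last : ∀ i j r → Gᵢ i j r ≗ Iᶠ Hˡ i j r
  Gᵢ-last zero    j r n = refl
  Gᵢ-last (suc i) j r   = shift-cong (6 * (j + r)) (G-last i j r)

  Gⱼ-last : ∀ i j r → Gⱼ i j r ≗ Jᶠ Hˡ i j r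
  Gⱼ-last i zero    r n = refl
  Gⱼ-last i (suc j) r   = shift-cong (6 * r) (G-last i j r)

  Gᵣ-last : ∀ i j r → Gᵣ i j r ≗ Rᶠ Hˡ i j r
  Gᵣ-last i j zero    n = refl
  Gᵣ-last i j (suc r) n = cong₂ _+_ (G-last i j r n) (shift-cong (3 * suc r) (G-last i j r) n)

Iˢ : Fam₃ → Fam₃
Iˢ P zero    j r = 𝟘
Iˢ P (suc i) j r = shift (6 * r) (P i j r)

Iᶠ⊞Jᶠ-swap : Iᶠ G ⊞ Jᶠ G ≋ Iˢ G ⊞ Jˡ G
Iᶠ⊞Jᶠ-swap zero    zero    r n = refl
Iᶠ⊞Jᶠ-swap zero    (suc j) r n = refl
Iᶠ⊞Jᶠ-swap (suc i) zero    r n = refl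
Iᶠ⊞Jᶠ-swap (suc i) (suc j) r n =
  trans (pascalⱼ i (suc j) r n)
        (cong (shift (6 * r) (G i (suc j) r) n +_)
              (shift-shift (6 * suc i) (6 * r) (G (suc i) j r) (sym (*-distribˡ-+ 6 (suc i) r)) n))

G-swapped : G ≋ base ⊞ Iˢ G ⊞ Jˡ G ⊞ Rᶠ G
G-swapped i j r n =
  trans (G-first i j r n)
    (cong (_+ Rᶠ G i j r n) (trans (+-assoc (base i j r n) (Iᶠ G i j r n) (Jᶠ G i j r n))
      (trans (cong (base i j r n +_) (Iᶠ⊞Jᶠ-swap i j r n))
             (sym (+-assoc (base i j r n) (Iˢ G i j r n) (Jˡ G i j r n))))))

base-sym : ∀ i j r → base i j r ≗ base j i r
base-sym zero    zero    r n = refl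
base-sym zero    (suc j) r n = refl
base-sym (suc i) zero    zero    n = refl
base-sym (suc i) zero    (suc r) n = refl
base-sym (suc i) (suc j) r n = refl

-- The swapped recurrence is the defining one with i and j exchanged.
mutual
  G-sym : ∀ i j r → G i j r ≗ G j i r
  G-sym i j r n = begin
    G i j r n
      ≡⟨ G-swapped i j r n ⟩
    base i j r n + Iˢ G i j r n + Jˡ G i j r n + Rᶠ G i j r n
      ≡⟨ +-cong₄ (base-sym i j r n) (sym (Gⱼ-sym i j r n)) (sym (Gᵢ-sym i j r n)) (sym (Gᵣ-sym i j r n)) ⟩
    base j i r n + Gⱼ j i r n + Gᵢ j i r n + Gᵣ j i r n
      ≡⟨ cong (_+ Gᵣ j i r n) (+-swapʳ (base j i r n) (Gⱼ j i r n) (Gᵢ j i r n)) ⟩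
    G j i r n
      ∎
    where
    open ≡-Reasoning
    +-swapʳ : ∀ a b c → a + b + c ≡ a + c + b
    +-swapʳ = solve-∀

  Gᵢ-sym : ∀ i j r → Gᵢ j i r ≗ Jˡ G i j r
  Gᵢ-sym i zero    r n = refl
  Gᵢ-sym i (suc j) r   = shift-cong (6 * (i + r)) (G-sym j i r)

  Gⱼ-sym : ∀ i j r → Gⱼ j i r ≗ Iˢ G i j r
  Gⱼ-sym zero    j r n = refl
  Gⱼ-sym (suc i) j r   = shift-cong (6 * r) (G-sym j i r)

  Gᵣ-sym : ∀ i j r → Gᵣ j i r ≗ Rᶠ G i j r
  Gᵣ-sym i j zero    n = refl
  Gᵣ-sym i j (suc r) n = cong₂ _+_ (G-sym j i r n) (shift-cong (3 * suc r) (G-sym j i r) n)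

-- The star recurrence mirrors that of D^I, where a new largest part exchanges odd and even positions.
Iˣ Rˣ : Fam₃ → Fam₃
Iˣ P zero    j r = 𝟘
Iˣ P (suc i) j r = shift (3 * r) (P j i r)
Rˣ P i j zero    = 𝟘
Rˣ P i j (suc r) = P i j r ⊕ shift (3 * suc r + 6 * i) (P j i r)

Iˣ-from-Iˡ : ∀ i j r → Iˣ G i j r ≗ shift (3 * r) (Iˡ G i j r)
Iˣ-from-Iˡ zero    j r n = sym (shift-𝟘 (3 * r) n)
Iˣ-from-Iˡ (suc i) j r   = shift-cong (3 * r) (G-sym j i r)

Iˢ-from-Iˣ : ∀ i j r → Iˢ G i j r ≗ shift (3 * r) (Iˣ G i j r)
Iˢ-from-Iˣ zero    j r n = sym (shift-𝟘 (3 * r) n)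
Iˢ-from-Iˣ (suc i) j r n =
  sym (trans (shift-shift (3 * r) (3 * r) (G j i r) (double r) n) (shift-cong (6 * r) (G-sym j i r) n))
  where
  double : ∀ r → 3 * r + 3 * r ≡ 6 * r
  double = solve-∀

Rᶠ-Rˡ-to-Rˣ : ∀ i j r → Rᶠ G i j r ⊕ shift (3 * r) (Rˡ G i j r) ≗ Rˣ G i j r ⊕ shift (3 * r) (Rˣ G i j r)
Rᶠ-Rˡ-to-Rˣ i j zero    n = refl
Rᶠ-Rˡ-to-Rˣ i j (suc r) n = begin
  (A n + shift c A n) + shift c (shift (6 * i) (A ⊕ shift c A)) n
    ≡⟨ cong ((A n + shift c A n) +_) shifted ⟩
  (A n + shift c A n) + (shift d A n + shift c (shift d A) n)
    ≡⟨ +-interchange (A n) (shift c A n) (shift d A n) (shift c (shift d A) n) ⟩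
  (A n + shift d A n) + (shift c A n + shift c (shift d A) n)
    ≡⟨ cong ((A n + shift d A n) +_) (sym (shift-⊕ c A (shift d A) n)) ⟩
  (A ⊕ shift d A) n + shift c (A ⊕ shift d A) n
    ≡⟨ cong₂ _+_ (A-sym n) (shift-cong c A-sym n) ⟩
  (A ⊕ shift d (G j i r)) n + shift c (A ⊕ shift d (G j i r)) n
    ∎
  where
  open ≡-Reasoning
  A = G i j r
  c d : ℕ
  c = 3 * suc r
  d = c + 6 * i
  shifted : shift c (shift (6 * i) (A ⊕ shift c A)) n ≡ shift d A n + shift c (shift d A) n
  shifted = begin
    shift c (shift (6 * i) (A ⊕ shift c A)) n ≡⟨ shift-shift c (6 * i) (A ⊕ shift c A) refl n ⟩
    shift d (A ⊕ shift c A) n                 ≡⟨ shift-⊕ d A (shift c A) n ⟩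
    shift d A n + shift d (shift c A) n       ≡⟨ cong (shift d A n +_) (shift-comm d c A n) ⟩
    shift d A n + shift c (shift d A) n       ∎
  A-sym : A ⊕ shift d A ≗ A ⊕ shift d (G j i r)
  A-sym x = cong (A x +_) (shift-cong d (G-sym i j r) x)

-- Both sides agree after multiplication by 1 + q^{3r}: then the swapped recurrence and q^{3r} times
-- the last-letter recurrence can be matched term by term.
G-star : G ≋ base ⊞ Iˣ G ⊞ Jˡ G ⊞ Rˣ G
G-star i j r = ⊕shift-injective k λ n → begin
  G i j r n + shift k (G i j r) n
    ≡⟨ cong₂ _+_ (G-swapped i j r n)
                 (trans (shift-cong k (G-last i j r) n) (shift-⊕₄ k (at base) (at (Iˡ G)) (at (Jˡ G)) (at (Rˡ G)) n)) ⟩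
  (at base n + at (Iˢ G) n + at (Jˡ G) n + at (Rᶠ G) n)
    + (up base n + up (Iˡ G) n + up (Jˡ G) n + up (Rˡ G) n)
    ≡⟨ regroup₁ (at base n) (at (Iˢ G) n) (at (Jˡ G) n) (at (Rᶠ G) n)
                (up base n) (up (Iˡ G) n) (up (Jˡ G) n) (up (Rˡ G) n) ⟩
  (at base n + at (Jˡ G) n + up base n + up (Jˡ G) n)
    + (at (Iˢ G) n + up (Iˡ G) n) + (at (Rᶠ G) n + up (Rˡ G) n)
    ≡⟨ cong₂ _+_ (cong ((at base n + at (Jˡ G) n + up base n + up (Jˡ G) n) +_)
                       (cong₂ _+_ (Iˢ-from-Iˣ i j r n) (sym (Iˣ-from-Iˡ i j r n))))
                 (Rᶠ-Rˡ-to-Rˣ i j r n) ⟩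
  (at base n + at (Jˡ G) n + up base n + up (Jˡ G) n)
    + (up (Iˣ G) n + at (Iˣ G) n) + (at (Rˣ G) n + up (Rˣ G) n)
    ≡⟨ regroup₂ (at base n) (at (Iˣ G) n) (at (Jˡ G) n) (at (Rˣ G) n)
                (up base n) (up (Iˣ G) n) (up (Jˡ G) n) (up (Rˣ G) n) ⟩
  (at base n + at (Iˣ G) n + at (Jˡ G) n + at (Rˣ G) n)
    + (up base n + up (Iˣ G) n + up (Jˡ G) n + up (Rˣ G) n)
    ≡⟨ cong (S n +_) (sym (shift-⊕₄ k (at base) (at (Iˣ G)) (at (Jˡ G)) (at (Rˣ G)) n)) ⟩
  S n + shift k S n
    ∎
  where
  open ≡-Reasoning
  k = 3 * r
  at : Fam₃ → Series
  at P = P i j r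
  up : Fam₃ → Series
  up P = shift k (P i j r)
  S = (base ⊞ Iˣ G ⊞ Jˡ G ⊞ Rˣ G) i j r
  regroup₁ : ∀ b x y z b′ x′ y′ z′ → (b + x + y + z) + (b′ + x′ + y′ + z′) ≡ (b + y + b′ + y′) + (x + x′) + (z + z′)
  regroup₁ = solve-∀
  regroup₂ : ∀ b x y z b′ x′ y′ z′ → (b + y + b′ + y′) + (x′ + x) + (z + z′) ≡ (b + x + y + z) + (b′ + x′ + y′ + z′)
  regroup₂ = solve-∀

-- Counting distinct partitions by their largest part

countL-++ : ∀ p (xs ys : List (List ℕ)) → countL p (xs ++ ys) ≡ countL p xs + countL p ys
countL-++ p []       ys = refl
countL-++ p (x ∷ xs) ys with p x
... | true  = cong suc (countL-++ p xs ys)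
... | false = countL-++ p xs ys

countL-map : ∀ p (f : List ℕ → List ℕ) xs → countL p (map f xs) ≡ countL (λ x → p (f x)) xs
countL-map p f []       = refl
countL-map p f (x ∷ xs) with p (f x)
... | true  = cong suc (countL-map p f xs)
... | false = countL-map p f xs

countL-cong : ∀ {p q : List ℕ → Bool} → (∀ x → p x ≡ q x) → ∀ xs → countL p xs ≡ countL q xs
countL-cong p≡q []       = refl
countL-cong {p} {q} p≡q (x ∷ xs) rewrite p≡q x with q x
... | true  = cong suc (countL-cong p≡q xs)
... | false = countL-cong p≡q xs

countL-false : ∀ (xs : List (List ℕ)) → countL (λ _ → false) xs ≡ 0
countL-false []       = refl
countL-false (x ∷ xs) = countL-false xs

shift-≤ᵇ : ∀ k f n → shift k f n ≡ (if k ≤ᵇ n then f (n ∸ k) else 0)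
shift-≤ᵇ zero          f n       = refl
shift-≤ᵇ (suc k)       f zero    = refl
shift-≤ᵇ (suc zero)    f (suc n) = refl
shift-≤ᵇ (suc (suc k)) f (suc n) = shift-≤ᵇ (suc k) f n

countL-dparts-suc : ∀ (p : List ℕ → Bool) k n →
  countL p (dparts (suc k) n) ≡ countL p (dparts k n) + shift (suc k) (λ n′ → countL (λ π → p (suc k ∷ π)) (dparts k n′)) n
countL-dparts-suc p k n = begin
  countL p (map (suc k ∷_) with-k ++ dparts k n)
    ≡⟨ countL-++ p (map (suc k ∷_) with-k) (dparts k n) ⟩
  countL p (map (suc k ∷_) with-k) + countL p (dparts k n)
    ≡⟨ cong (_+ countL p (dparts k n)) (trans (countL-map p (suc k ∷_) with-k) (guarded (suc k ≤ᵇ n))) ⟩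
  (if suc k ≤ᵇ n then countL p′ (dparts k (n ∸ suc k)) else 0) + countL p (dparts k n)
    ≡⟨ cong (_+ countL p (dparts k n)) (sym (shift-≤ᵇ (suc k) (λ n′ → countL p′ (dparts k n′)) n)) ⟩
  shift (suc k) (λ n′ → countL p′ (dparts k n′)) n + countL p (dparts k n)
    ≡⟨ +-comm _ (countL p (dparts k n)) ⟩
  countL p (dparts k n) + shift (suc k) (λ n′ → countL p′ (dparts k n′)) n
    ∎
  where
  open ≡-Reasoning
  with-k = if suc k ≤ᵇ n then dparts k (n ∸ suc k) else []
  p′ : List ℕ → Bool
  p′ π = p (suc k ∷ π)
  guarded : ∀ b → countL p′ (if b then dparts k (n ∸ suc k) else []) ≡ (if b then countL p′ (dparts k (n ∸ suc k)) else 0)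
  guarded true  = refl
  guarded false = refl

PFam : Set
PFam = ℕ → ℕ → List ℕ → Bool

Fam₂ : Set
Fam₂ = ℕ → ℕ → Series

count : PFam → ℕ → Fam₂
count P k a b n = countL (P a b) (dparts k n)

infix 4 _≈_
_≈_ : Fam₂ → Fam₂ → Set
F ≈ G = ∀ a b → F a b ≗ G a b

≈-setoid : Setoid _ _
≈-setoid = record
  { Carrier       = Fam₂
  ; _≈_           = _≈_
  ; isEquivalence = record
    { refl  = λ a b n → refl
    ; sym   = λ F≈G a b n → sym (F≈G a b n)
    ; trans = λ F≈G G≈H a b n → trans (F≈G a b n) (G≈H a b n)
    }
  }

open Setoid ≈-setoid using () renaming (refl to ≈-refl; sym to ≈-sym; trans to ≈-trans)

onPred : ℕ → (ℕ → Bool) → Bool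
onPred zero    g = false
onPred (suc a) g = g a

data Kind : Set where
  free tallyA tallyB : Kind

-- The weight of a new part v of the given kind: free parts leave (a, b) alone, the others raise a or b.
lower : Kind → ℕ → Fam₂ → Fam₂
lower free   v F a       b       = shift v (F a b)
lower tallyA v F zero    b       = 𝟘
lower tallyA v F (suc a) b       = shift v (F a b)
lower tallyB v F a       zero    = 𝟘
lower tallyB v F a       (suc b) = shift v (F a b)

allow : Kind → Bool → ℕ → Fam₂ → Fam₂
allow k false v F     = F
allow k true  v F a b = F a b ⊕ lower k v F a b

swapPart : ℕ → Fam₂ → Fam₂
swapPart v F i j = F i j ⊕ shift v (F j i)

swapCountPart : ℕ → Fam₂ → Fam₂
swapCountPart w F i j = F i j ⊕ lower tallyA w (λ a b → F b a) i j

count-suc : ∀ P k a b (q : List ℕ → Bool) → (∀ π → P a b (suc k ∷ π) ≡ q π) →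
  count P (suc k) a b ≗ count P k a b ⊕ shift (suc k) (λ n → countL q (dparts k n))
count-suc P k a b q head n =
  trans (countL-dparts-suc (P a b) k n)
        (cong (count P k a b n +_) (shift-cong (suc k) (λ n′ → countL-cong head (dparts k n′)) n))

count-skip-at : ∀ P k a b → (∀ π → P a b (suc k ∷ π) ≡ false) → count P (suc k) a b ≗ count P k a b
count-skip-at P k a b head n =
  trans (count-suc P k a b (λ _ → false) head n)
        (trans (cong (count P k a b n +_) (shift-vanishes (suc k) (λ n′ → countL-false (dparts k n′)) n))
               (+-identityʳ _))

count-skip : ∀ P k → (∀ a b π → P a b (suc k ∷ π) ≡ false) → count P (suc k) ≈ count P k
count-skip P k head a b = count-skip-at P k a b (head a b)

count-free : ∀ P k ok → (∀ a b π → P a b (suc k ∷ π) ≡ ok ∧ P a b π) → count P (suc k) ≈ allow free ok (suc k) (count P k)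
count-free P k false head     = count-skip P k head
count-free P k true  head a b = count-suc P k a b (P a b) (head a b)

count-tallyA : ∀ P k ok → (∀ a b π → P a b (suc k ∷ π) ≡ ok ∧ onPred a (λ a′ → P a′ b π)) →
  count P (suc k) ≈ allow tallyA ok (suc k) (count P k)
count-tallyA P k false head           = count-skip P k head
count-tallyA P k true  head zero    b n = trans (count-skip-at P k 0 b (head 0 b) n) (sym (+-identityʳ _))
count-tallyA P k true  head (suc a) b   = count-suc P k (suc a) b (P a b) (head (suc a) b)

count-tallyB : ∀ P k ok → (∀ a b π → P a b (suc k ∷ π) ≡ ok ∧ onPred b (λ b′ → P a b′ π)) →
  count P (suc k) ≈ allow tallyB ok (suc k) (count P k)
count-tallyB P k false head           = count-skip P k head
count-tallyB P k true  head a zero    n = trans (count-skip-at P k a 0 (head a 0) n) (sym (+-identityʳ _))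
count-tallyB P k true  head a (suc b)   = count-suc P k a (suc b) (P a b) (head a (suc b))

count-swap : ∀ P k → (∀ i j π → P i j (suc k ∷ π) ≡ P j i π) → count P (suc k) ≈ swapPart (suc k) (count P k)
count-swap P k head i j = count-suc P k i j (P j i) (head i j)

count-swapCount : ∀ P k → (∀ i j π → P i j (suc k ∷ π) ≡ onPred i (λ i′ → P j i′ π)) →
  count P (suc k) ≈ swapCountPart (suc k) (count P k)
count-swapCount P k head zero    j n = trans (count-skip-at P k 0 j (head 0 j) n) (sym (+-identityʳ _))
count-swapCount P k head (suc i) j   = count-suc P k (suc i) j (P j i) (head (suc i) j)

lower-cong : ∀ k v {F G} → F ≈ G → lower k v F ≈ lower k v G
lower-cong free   v F≈G a       b       = shift-cong v (F≈G a b)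
lower-cong tallyA v F≈G zero    b n     = refl
lower-cong tallyA v F≈G (suc a) b       = shift-cong v (F≈G a b)
lower-cong tallyB v F≈G a       zero  n = refl
lower-cong tallyB v F≈G a       (suc b) = shift-cong v (F≈G a b)

lower-⊕ : ∀ k v F G a b → lower k v (λ a b → F a b ⊕ G a b) a b ≗ lower k v F a b ⊕ lower k v G a b
lower-⊕ free   v F G a       b       = shift-⊕ v (F a b) (G a b)
lower-⊕ tallyA v F G zero    b n     = refl
lower-⊕ tallyA v F G (suc a) b       = shift-⊕ v (F a b) (G a b)
lower-⊕ tallyB v F G a       zero  n = refl
lower-⊕ tallyB v F G a       (suc b) = shift-⊕ v (F a b) (G a b)

lower-comm : ∀ k₁ k₂ v w F → lower k₁ v (lower k₂ w F) ≈ lower k₂ w (lower k₁ v F)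
lower-comm free   free   v w F a             b             = shift-comm v w (F a b)
lower-comm free   tallyA v w F zero          b             = shift-𝟘 v
lower-comm free   tallyA v w F (suc a)       b             = shift-comm v w (F a b)
lower-comm free   tallyB v w F a             zero          = shift-𝟘 v
lower-comm free   tallyB v w F a             (suc b)       = shift-comm v w (F a b)
lower-comm tallyA free   v w F zero          b       n     = sym (shift-𝟘 w n)
lower-comm tallyA free   v w F (suc a)       b             = shift-comm v w (F a b)
lower-comm tallyA tallyA v w F zero          b       n     = refl
lower-comm tallyA tallyA v w F (suc zero)    b       n     = trans (shift-𝟘 v n) (sym (shift-𝟘 w n))
lower-comm tallyA tallyA v w F (suc (suc a)) b             = shift-comm v w (F a b)
lower-comm tallyA tallyB v w F zero          zero    n     = refl
lower-comm tallyA tallyB v w F zero          (suc b) n     = sym (shift-𝟘 w n)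
lower-comm tallyA tallyB v w F (suc a)       zero          = shift-𝟘 v
lower-comm tallyA tallyB v w F (suc a)       (suc b)       = shift-comm v w (F a b)
lower-comm tallyB free   v w F a             zero    n     = sym (shift-𝟘 w n)
lower-comm tallyB free   v w F a             (suc b)       = shift-comm v w (F a b)
lower-comm tallyB tallyA v w F zero          zero    n     = refl
lower-comm tallyB tallyA v w F zero          (suc b)       = shift-𝟘 v
lower-comm tallyB tallyA v w F (suc a)       zero    n     = sym (shift-𝟘 w n)
lower-comm tallyB tallyA v w F (suc a)       (suc b)       = shift-comm v w (F a b)
lower-comm tallyB tallyB v w F a             zero    n     = refl
lower-comm tallyB tallyB v w F a             (suc zero) n  = trans (shift-𝟘 v n) (sym (shift-𝟘 w n))
lower-comm tallyB tallyB v w F a             (suc (suc b)) = shift-comm v w (F a b)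

allow-cong : ∀ k ok v {F G} → F ≈ G → allow k ok v F ≈ allow k ok v G
allow-cong k false v F≈G         = F≈G
allow-cong k true  v F≈G a b n = cong₂ _+_ (F≈G a b n) (lower-cong k v F≈G a b n)

-- Allowing parts of different sizes commutes: these are the independent factors of a product.
allow-comm : ∀ k₁ k₂ ok₁ ok₂ v w F → allow k₁ ok₁ v (allow k₂ ok₂ w F) ≈ allow k₂ ok₂ w (allow k₁ ok₁ v F)
allow-comm k₁ k₂ false ok₂  v w F = ≈-refl
allow-comm k₁ k₂ true  false v w F = ≈-refl
allow-comm k₁ k₂ true  true  v w F a b n = begin
  (F a b n + lower k₂ w F a b n) + lower k₁ v (λ a b → F a b ⊕ lower k₂ w F a b) a b n
    ≡⟨ cong ((F a b n + lower k₂ w F a b n) +_) (lower-⊕ k₁ v F (lower k₂ w F) a b n) ⟩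
  (F a b n + lower k₂ w F a b n) + (lower k₁ v F a b n + lower k₁ v (lower k₂ w F) a b n)
    ≡⟨ +-interchange (F a b n) (lower k₂ w F a b n) (lower k₁ v F a b n) _ ⟩
  (F a b n + lower k₁ v F a b n) + (lower k₂ w F a b n + lower k₁ v (lower k₂ w F) a b n)
    ≡⟨ cong (λ x → (F a b n + lower k₁ v F a b n) + (lower k₂ w F a b n + x)) (lower-comm k₁ k₂ v w F a b n) ⟩
  (F a b n + lower k₁ v F a b n) + (lower k₂ w F a b n + lower k₂ w (lower k₁ v F) a b n)
    ≡⟨ cong ((F a b n + lower k₁ v F a b n) +_) (sym (lower-⊕ k₂ w F (lower k₁ v F) a b n)) ⟩
  (F a b n + lower k₁ v F a b n) + lower k₂ w (λ a b → F a b ⊕ lower k₁ v F a b) a b n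
    ∎
  where open ≡-Reasoning

swapPart-cong : ∀ v {F G} → F ≈ G → swapPart v F ≈ swapPart v G
swapPart-cong v F≈G i j n = cong₂ _+_ (F≈G i j n) (shift-cong v (F≈G j i) n)

swapCountPart-cong : ∀ w {F G} → F ≈ G → swapCountPart w F ≈ swapCountPart w G
swapCountPart-cong w F≈G zero    j n = cong (_+ 0) (F≈G zero j n)
swapCountPart-cong w F≈G (suc i) j n = cong₂ _+_ (F≈G (suc i) j n) (shift-cong w (F≈G j i) n)

module ≈-Reasoning = Relation.Binary.Reasoning.Setoid ≈-setoid

-- The generating function of D^II

≤ᵇ-true : ∀ {x y} → x ≤ y → (x ≤ᵇ y) ≡ true
≤ᵇ-true {x} {y} x≤y with x ≤ᵇ y | ≤⇒≤ᵇ x≤y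
... | true | _ = refl

≤ᵇ-false : ∀ {x y} → y < x → (x ≤ᵇ y) ≡ false
≤ᵇ-false {x} {y} y<x with x ≤ᵇ y in eq
... | false = refl
... | true  = ⊥-elim (<⇒≱ y<x (≤ᵇ⇒≤ x y (subst T (sym eq) _)))

𝟙₂ : Fam₂
𝟙₂ zero    zero    = 𝟙
𝟙₂ zero    (suc b) = 𝟘
𝟙₂ (suc a) b       = 𝟘

-- The parts of (6L, 6L + 6] that are ≢ −m mod 3, in increasing order: 6L + m (counted by a), 6L + 3,
-- 6L + m + 3 (counted by b) and 6L + 6, each allowed according to its flag.
block : ℕ → ℕ → Bool → Bool → Bool → Bool → Fam₂ → Fam₂
block m L okA ok₃ okB ok₆ F =
  allow free ok₆ (6 + 6 * L) (allow tallyB okB (3 + m + 6 * L) (allow free ok₃ (3 + 6 * L) (allow tallyA okA (m + 6 * L) F)))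

-- Parts ≡ m mod 6 are at most 6A + m − 6, parts ≡ m + 3 mod 6 at most 6B + m − 3, parts ≡ 0 mod 3 at most 3Γ.
DIIgf : ℕ → ℕ → ℕ → ℕ → ℕ → Fam₂
DIIgf m zero    A B Γ = 𝟙₂
DIIgf m (suc L) A B Γ =
  block m L (suc L ≤ᵇ A) (suc (2 * L) ≤ᵇ Γ) (suc L ≤ᵇ B) (suc (suc (2 * L)) ≤ᵇ Γ) (DIIgf m L A B Γ)

block-cong : ∀ m L okA ok₃ okB ok₆ {F G} → F ≈ G → block m L okA ok₃ okB ok₆ F ≈ block m L okA ok₃ okB ok₆ G
block-cong m L okA ok₃ okB ok₆ F≈G =
  allow-cong free ok₆ _ (allow-cong tallyB okB _ (allow-cong free ok₃ _ (allow-cong tallyA okA _ F≈G)))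

block-comm : ∀ m L okA ok₃ okB ok₆ k ok v F →
  block m L okA ok₃ okB ok₆ (allow k ok v F) ≈ allow k ok v (block m L okA ok₃ okB ok₆ F)
block-comm m L okA ok₃ okB ok₆ k ok v F = begin
  allow free ok₆ v₆ (allow tallyB okB vB (allow free ok₃ v₃ (allow tallyA okA vA (allow k ok v F))))
    ≈⟨ allow-cong free ok₆ v₆ (allow-cong tallyB okB vB (allow-cong free ok₃ v₃ (allow-comm tallyA k okA ok vA v F))) ⟩
  allow free ok₆ v₆ (allow tallyB okB vB (allow free ok₃ v₃ (allow k ok v (allow tallyA okA vA F))))
    ≈⟨ allow-cong free ok₆ v₆ (allow-cong tallyB okB vB (allow-comm free k ok₃ ok v₃ v _)) ⟩
  allow free ok₆ v₆ (allow tallyB okB vB (allow k ok v (allow free ok₃ v₃ (allow tallyA okA vA F))))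
    ≈⟨ allow-cong free ok₆ v₆ (allow-comm tallyB k okB ok vB v _) ⟩
  allow free ok₆ v₆ (allow k ok v (allow tallyB okB vB (allow free ok₃ v₃ (allow tallyA okA vA F))))
    ≈⟨ allow-comm free k ok₆ ok v₆ v _ ⟩
  allow k ok v (allow free ok₆ v₆ (allow tallyB okB vB (allow free ok₃ v₃ (allow tallyA okA vA F))))
    ∎
  where
  open ≈-Reasoning
  v₆ = 6 + 6 * L
  vB = 3 + m + 6 * L
  v₃ = 3 + 6 * L
  vA = m + 6 * L

block-pullA : ∀ m L ok₃ okB ok₆ F →
  block m L true ok₃ okB ok₆ F ≈ allow tallyA true (m + 6 * L) (block m L false ok₃ okB ok₆ F)
block-pullA m L ok₃ okB ok₆ F = begin
  allow free ok₆ v₆ (allow tallyB okB vB (allow free ok₃ v₃ (allow tallyA true vA F)))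
    ≈⟨ allow-cong free ok₆ v₆ (allow-cong tallyB okB vB (allow-comm free tallyA ok₃ true v₃ vA F)) ⟩
  allow free ok₆ v₆ (allow tallyB okB vB (allow tallyA true vA (allow free ok₃ v₃ F)))
    ≈⟨ allow-cong free ok₆ v₆ (allow-comm tallyB tallyA okB true vB vA _) ⟩
  allow free ok₆ v₆ (allow tallyA true vA (allow tallyB okB vB (allow free ok₃ v₃ F)))
    ≈⟨ allow-comm free tallyA ok₆ true v₆ vA _ ⟩
  allow tallyA true vA (allow free ok₆ v₆ (allow tallyB okB vB (allow free ok₃ v₃ F)))
    ∎
  where
  open ≈-Reasoning
  v₆ = 6 + 6 * L
  vB = 3 + m + 6 * L
  v₃ = 3 + 6 * L
  vA = m + 6 * L

block-pull₃ : ∀ m L okA okB ok₆ F →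
  block m L okA true okB ok₆ F ≈ allow free true (3 + 6 * L) (block m L okA false okB ok₆ F)
block-pull₃ m L okA okB ok₆ F = begin
  allow free ok₆ v₆ (allow tallyB okB vB (allow free true v₃ F′))
    ≈⟨ allow-cong free ok₆ v₆ (allow-comm tallyB free okB true vB v₃ F′) ⟩
  allow free ok₆ v₆ (allow free true v₃ (allow tallyB okB vB F′))
    ≈⟨ allow-comm free free ok₆ true v₆ v₃ _ ⟩
  allow free true v₃ (allow free ok₆ v₆ (allow tallyB okB vB F′))
    ∎
  where
  open ≈-Reasoning
  v₆ = 6 + 6 * L
  vB = 3 + m + 6 * L
  v₃ = 3 + 6 * L
  F′ = allow tallyA okA (m + 6 * L) F

block-pullB : ∀ m L okA ok₃ ok₆ F →
  block m L okA ok₃ true ok₆ F ≈ allow tallyB true (3 + m + 6 * L) (block m L okA ok₃ false ok₆ F)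
block-pullB m L okA ok₃ ok₆ F = allow-comm free tallyB ok₆ true (6 + 6 * L) (3 + m + 6 * L) _

both-true : ∀ {x y y′} → x ≤ y → x ≤ y′ → (x ≤ᵇ y) ≡ (x ≤ᵇ y′)
both-true x≤y x≤y′ = trans (≤ᵇ-true x≤y) (sym (≤ᵇ-true x≤y′))

both-false : ∀ {x y y′} → y < x → y′ < x → (x ≤ᵇ y) ≡ (x ≤ᵇ y′)
both-false y<x y′<x = trans (≤ᵇ-false y<x) (sym (≤ᵇ-false y′<x))

DIIgf-sucA-saturated : ∀ m L A B Γ → L ≤ A → DIIgf m L (suc A) B Γ ≈ DIIgf m L A B Γ
DIIgf-sucA-saturated m zero    A B Γ _   = ≈-refl
DIIgf-sucA-saturated m (suc L) A B Γ L<A = begin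
  block m L (suc L ≤ᵇ suc A) ok₃ okB ok₆ (DIIgf m L (suc A) B Γ)
    ≈⟨ block-cong m L (suc L ≤ᵇ suc A) ok₃ okB ok₆ (DIIgf-sucA-saturated m L A B Γ (<⇒≤ L<A)) ⟩
  block m L (suc L ≤ᵇ suc A) ok₃ okB ok₆ (DIIgf m L A B Γ)
    ≡⟨ cong (λ o → block m L o ok₃ okB ok₆ (DIIgf m L A B Γ)) (both-true (m≤n⇒m≤1+n L<A) L<A) ⟩
  DIIgf m (suc L) A B Γ
    ∎
  where
  open ≈-Reasoning
  ok₃ = suc (2 * L) ≤ᵇ Γ
  okB = suc L ≤ᵇ B
  ok₆ = suc (suc (2 * L)) ≤ᵇ Γ

DIIgf-sucA : ∀ m L A B Γ → A < L → DIIgf m L (suc A) B Γ ≈ allow tallyA true (m + 6 * A) (DIIgf m L A B Γ)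
DIIgf-sucA m (suc L) A B Γ A<1+L with m<1+n⇒m<n∨m≡n A<1+L
... | inj₂ refl = begin
  block m A (suc A ≤ᵇ suc A) ok₃ okB ok₆ (DIIgf m A (suc A) B Γ)
    ≈⟨ block-cong m A (suc A ≤ᵇ suc A) ok₃ okB ok₆ (DIIgf-sucA-saturated m A A B Γ ≤-refl) ⟩
  block m A (suc A ≤ᵇ suc A) ok₃ okB ok₆ (DIIgf m A A B Γ)
    ≡⟨ cong (λ o → block m A o ok₃ okB ok₆ (DIIgf m A A B Γ)) (≤ᵇ-true (≤-refl {suc A})) ⟩
  block m A true ok₃ okB ok₆ (DIIgf m A A B Γ)
    ≈⟨ block-pullA m A ok₃ okB ok₆ _ ⟩
  allow tallyA true (m + 6 * A) (block m A false ok₃ okB ok₆ (DIIgf m A A B Γ))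
    ≡⟨ cong (λ o → allow tallyA true (m + 6 * A) (block m A o ok₃ okB ok₆ (DIIgf m A A B Γ))) (sym (≤ᵇ-false {suc A} {A} ≤-refl)) ⟩
  allow tallyA true (m + 6 * A) (DIIgf m (suc A) A B Γ)
    ∎
  where
  open ≈-Reasoning
  ok₃ = suc (2 * A) ≤ᵇ Γ
  okB = suc A ≤ᵇ B
  ok₆ = suc (suc (2 * A)) ≤ᵇ Γ
... | inj₁ A<L = begin
  block m L (suc L ≤ᵇ suc A) ok₃ okB ok₆ (DIIgf m L (suc A) B Γ)
    ≡⟨ cong (λ o → block m L o ok₃ okB ok₆ (DIIgf m L (suc A) B Γ)) (both-false (s≤s A<L) (m<n⇒m<1+n A<L)) ⟩
  block m L okA ok₃ okB ok₆ (DIIgf m L (suc A) B Γ)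
    ≈⟨ block-cong m L okA ok₃ okB ok₆ (DIIgf-sucA m L A B Γ A<L) ⟩
  block m L okA ok₃ okB ok₆ (allow tallyA true (m + 6 * A) (DIIgf m L A B Γ))
    ≈⟨ block-comm m L okA ok₃ okB ok₆ tallyA true (m + 6 * A) _ ⟩
  allow tallyA true (m + 6 * A) (DIIgf m (suc L) A B Γ)
    ∎
  where
  open ≈-Reasoning
  okA = suc L ≤ᵇ A
  ok₃ = suc (2 * L) ≤ᵇ Γ
  okB = suc L ≤ᵇ B
  ok₆ = suc (suc (2 * L)) ≤ᵇ Γ

DIIgf-sucB-saturated : ∀ m L A B Γ → L ≤ B → DIIgf m L A (suc B) Γ ≈ DIIgf m L A B Γ
DIIgf-sucB-saturated m zero    A B Γ _   = ≈-refl
DIIgf-sucB-saturated m (suc L) A B Γ L<B = begin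
  block m L okA ok₃ (suc L ≤ᵇ suc B) ok₆ (DIIgf m L A (suc B) Γ)
    ≈⟨ block-cong m L okA ok₃ (suc L ≤ᵇ suc B) ok₆ (DIIgf-sucB-saturated m L A B Γ (<⇒≤ L<B)) ⟩
  block m L okA ok₃ (suc L ≤ᵇ suc B) ok₆ (DIIgf m L A B Γ)
    ≡⟨ cong (λ o → block m L okA ok₃ o ok₆ (DIIgf m L A B Γ)) (both-true (m≤n⇒m≤1+n L<B) L<B) ⟩
  DIIgf m (suc L) A B Γ
    ∎
  where
  open ≈-Reasoning
  okA = suc L ≤ᵇ A
  ok₃ = suc (2 * L) ≤ᵇ Γ
  ok₆ = suc (suc (2 * L)) ≤ᵇ Γ

DIIgf-sucB : ∀ m L A B Γ → B < L → DIIgf m L A (suc B) Γ ≈ allow tallyB true (3 + m + 6 * B) (DIIgf m L A B Γ)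
DIIgf-sucB m (suc L) A B Γ B<1+L with m<1+n⇒m<n∨m≡n B<1+L
... | inj₂ refl = begin
  block m B okA ok₃ (suc B ≤ᵇ suc B) ok₆ (DIIgf m B A (suc B) Γ)
    ≈⟨ block-cong m B okA ok₃ (suc B ≤ᵇ suc B) ok₆ (DIIgf-sucB-saturated m B A B Γ ≤-refl) ⟩
  block m B okA ok₃ (suc B ≤ᵇ suc B) ok₆ (DIIgf m B A B Γ)
    ≡⟨ cong (λ o → block m B okA ok₃ o ok₆ (DIIgf m B A B Γ)) (≤ᵇ-true (≤-refl {suc B})) ⟩
  block m B okA ok₃ true ok₆ (DIIgf m B A B Γ)
    ≈⟨ block-pullB m B okA ok₃ ok₆ _ ⟩
  allow tallyB true (3 + m + 6 * B) (block m B okA ok₃ false ok₆ (DIIgf m B A B Γ))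
    ≡⟨ cong (λ o → allow tallyB true (3 + m + 6 * B) (block m B okA ok₃ o ok₆ (DIIgf m B A B Γ))) (sym (≤ᵇ-false {suc B} {B} ≤-refl)) ⟩
  allow tallyB true (3 + m + 6 * B) (DIIgf m (suc B) A B Γ)
    ∎
  where
  open ≈-Reasoning
  okA = suc B ≤ᵇ A
  ok₃ = suc (2 * B) ≤ᵇ Γ
  ok₆ = suc (suc (2 * B)) ≤ᵇ Γ
... | inj₁ B<L = begin
  block m L okA ok₃ (suc L ≤ᵇ suc B) ok₆ (DIIgf m L A (suc B) Γ)
    ≡⟨ cong (λ o → block m L okA ok₃ o ok₆ (DIIgf m L A (suc B) Γ)) (both-false (s≤s B<L) (m<n⇒m<1+n B<L)) ⟩
  block m L okA ok₃ okB ok₆ (DIIgf m L A (suc B) Γ)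
    ≈⟨ block-cong m L okA ok₃ okB ok₆ (DIIgf-sucB m L A B Γ B<L) ⟩
  block m L okA ok₃ okB ok₆ (allow tallyB true (3 + m + 6 * B) (DIIgf m L A B Γ))
    ≈⟨ block-comm m L okA ok₃ okB ok₆ tallyB true (3 + m + 6 * B) _ ⟩
  allow tallyB true (3 + m + 6 * B) (DIIgf m (suc L) A B Γ)
    ∎
  where
  open ≈-Reasoning
  okA = suc L ≤ᵇ A
  ok₃ = suc (2 * L) ≤ᵇ Γ
  okB = suc L ≤ᵇ B
  ok₆ = suc (suc (2 * L)) ≤ᵇ Γ

DIIgf-sucΓ-saturated : ∀ m L A B Γ → 2 * L ≤ Γ → DIIgf m L A B (suc Γ) ≈ DIIgf m L A B Γ
DIIgf-sucΓ-saturated m zero    A B Γ _      = ≈-refl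
DIIgf-sucΓ-saturated m (suc L) A B Γ 2L+2≤Γ = begin
  block m L okA (suc (2 * L) ≤ᵇ suc Γ) okB (suc (suc (2 * L)) ≤ᵇ suc Γ) (DIIgf m L A B (suc Γ))
    ≈⟨ block-cong m L okA (suc (2 * L) ≤ᵇ suc Γ) okB (suc (suc (2 * L)) ≤ᵇ suc Γ)
                  (DIIgf-sucΓ-saturated m L A B Γ (≤-trans (n≤1+n (2 * L)) (<⇒≤ 2L+2≤Γ′))) ⟩
  block m L okA (suc (2 * L) ≤ᵇ suc Γ) okB (suc (suc (2 * L)) ≤ᵇ suc Γ) (DIIgf m L A B Γ)
    ≡⟨ cong₂ (λ o o′ → block m L okA o okB o′ (DIIgf m L A B Γ))
             (both-true (m≤n⇒m≤1+n (<⇒≤ 2L+2≤Γ′)) (<⇒≤ 2L+2≤Γ′)) (both-true (m≤n⇒m≤1+n 2L+2≤Γ′) 2L+2≤Γ′) ⟩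
  DIIgf m (suc L) A B Γ
    ∎
  where
  open ≈-Reasoning
  okA = suc L ≤ᵇ A
  okB = suc L ≤ᵇ B
  2L+2≤Γ′ : suc (suc (2 * L)) ≤ Γ
  2L+2≤Γ′ = subst (_≤ Γ) (*-suc 2 L) 2L+2≤Γ

DIIgf-sucΓ : ∀ m L A B Γ → Γ < 2 * L → DIIgf m L A B (suc Γ) ≈ allow free true (3 + 3 * Γ) (DIIgf m L A B Γ)
DIIgf-sucΓ m (suc L) A B Γ Γ<2L+2 with m<1+n⇒m<n∨m≡n (subst (Γ <_) (*-suc 2 L) Γ<2L+2)
... | inj₂ refl = begin
  block m L okA (suc (2 * L) ≤ᵇ suc Γ) okB (suc Γ ≤ᵇ suc Γ) (DIIgf m L A B (suc Γ))
    ≈⟨ block-cong m L okA (suc (2 * L) ≤ᵇ suc Γ) okB (suc Γ ≤ᵇ suc Γ) (DIIgf-sucΓ-saturated m L A B Γ (n≤1+n (2 * L))) ⟩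
  block m L okA (suc (2 * L) ≤ᵇ suc Γ) okB (suc Γ ≤ᵇ suc Γ) (DIIgf m L A B Γ)
    ≡⟨ cong₂ (λ o v → allow free o v (block m L okA (suc (2 * L) ≤ᵇ suc Γ) okB false (DIIgf m L A B Γ)))
             (≤ᵇ-true (≤-refl {suc Γ})) (exponent L) ⟩
  allow free true (3 + 3 * Γ) (block m L okA (suc (2 * L) ≤ᵇ suc Γ) okB false (DIIgf m L A B Γ))
    ≡⟨ cong₂ (λ o o′ → allow free true (3 + 3 * Γ) (block m L okA o okB o′ (DIIgf m L A B Γ)))
             (both-true (n≤1+n Γ) (≤-refl {Γ})) (sym (≤ᵇ-false {suc Γ} {Γ} ≤-refl)) ⟩
  allow free true (3 + 3 * Γ) (DIIgf m (suc L) A B Γ)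
    ∎
  where
  open ≈-Reasoning
  okA = suc L ≤ᵇ A
  okB = suc L ≤ᵇ B
  exponent : ∀ L → 6 + 6 * L ≡ 3 + 3 * suc (2 * L)
  exponent = solve-∀
... | inj₁ Γ<2L+1 with m<1+n⇒m<n∨m≡n Γ<2L+1
... | inj₂ refl = begin
  block m L okA (suc Γ ≤ᵇ suc Γ) okB (suc (suc Γ) ≤ᵇ suc Γ) (DIIgf m L A B (suc Γ))
    ≈⟨ block-cong m L okA (suc Γ ≤ᵇ suc Γ) okB (suc (suc Γ) ≤ᵇ suc Γ) (DIIgf-sucΓ-saturated m L A B Γ ≤-refl) ⟩
  block m L okA (suc Γ ≤ᵇ suc Γ) okB (suc (suc Γ) ≤ᵇ suc Γ) (DIIgf m L A B Γ)
    ≡⟨ cong₂ (λ o o′ → block m L okA o okB o′ (DIIgf m L A B Γ))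
             (≤ᵇ-true (≤-refl {suc Γ})) (both-false {suc (suc Γ)} (≤-refl {suc (suc Γ)}) (m<n⇒m<1+n (n<1+n Γ))) ⟩
  block m L okA true okB (suc (suc Γ) ≤ᵇ Γ) (DIIgf m L A B Γ)
    ≈⟨ block-pull₃ m L okA okB (suc (suc Γ) ≤ᵇ Γ) (DIIgf m L A B Γ) ⟩
  allow free true (3 + 6 * L) (block m L okA false okB (suc (suc Γ) ≤ᵇ Γ) (DIIgf m L A B Γ))
    ≡⟨ cong₂ (λ v o → allow free true v (block m L okA o okB (suc (suc Γ) ≤ᵇ Γ) (DIIgf m L A B Γ)))
             (exponent L) (sym (≤ᵇ-false {suc Γ} {Γ} ≤-refl)) ⟩
  allow free true (3 + 3 * Γ) (DIIgf m (suc L) A B Γ)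
    ∎
  where
  open ≈-Reasoning
  okA = suc L ≤ᵇ A
  okB = suc L ≤ᵇ B
  exponent : ∀ L → 3 + 6 * L ≡ 3 + 3 * (2 * L)
  exponent = solve-∀
... | inj₁ Γ<2L = begin
  block m L okA (suc (2 * L) ≤ᵇ suc Γ) okB (suc (suc (2 * L)) ≤ᵇ suc Γ) (DIIgf m L A B (suc Γ))
    ≡⟨ cong₂ (λ o o′ → block m L okA o okB o′ (DIIgf m L A B (suc Γ)))
             (both-false (s≤s Γ<2L) (m<n⇒m<1+n Γ<2L)) (both-false (s≤s Γ<2L+1) (m<n⇒m<1+n Γ<2L+1)) ⟩
  block m L okA ok₃ okB ok₆ (DIIgf m L A B (suc Γ))
    ≈⟨ block-cong m L okA ok₃ okB ok₆ (DIIgf-sucΓ m L A B Γ Γ<2L) ⟩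
  block m L okA ok₃ okB ok₆ (allow free true (3 + 3 * Γ) (DIIgf m L A B Γ))
    ≈⟨ block-comm m L okA ok₃ okB ok₆ free true (3 + 3 * Γ) _ ⟩
  allow free true (3 + 3 * Γ) (DIIgf m (suc L) A B Γ)
    ∎
  where
  open ≈-Reasoning
  okA = suc L ≤ᵇ A
  ok₃ = suc (2 * L) ≤ᵇ Γ
  okB = suc L ≤ᵇ B
  ok₆ = suc (suc (2 * L)) ≤ᵇ Γ

ZeroAtA : Fam₂ → ℕ → Set
ZeroAtA F a = ∀ b → F a b ≗ 𝟘

ZeroAtB : Fam₂ → ℕ → Set
ZeroAtB F b = ∀ a → F a b ≗ 𝟘

allow-free-zeroAtA : ∀ ok v F a → ZeroAtA F a → ZeroAtA (allow free ok v F) a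
allow-free-zeroAtA false v F a F≗𝟘     = F≗𝟘
allow-free-zeroAtA true  v F a F≗𝟘 b n = cong₂ _+_ (F≗𝟘 b n) (shift-vanishes v (F≗𝟘 b) n)

allow-tallyB-zeroAtA : ∀ ok v F a → ZeroAtA F a → ZeroAtA (allow tallyB ok v F) a
allow-tallyB-zeroAtA false v F a F≗𝟘           = F≗𝟘
allow-tallyB-zeroAtA true  v F a F≗𝟘 zero    n = cong (_+ 0) (F≗𝟘 zero n)
allow-tallyB-zeroAtA true  v F a F≗𝟘 (suc b) n = cong₂ _+_ (F≗𝟘 (suc b) n) (shift-vanishes v (F≗𝟘 b) n)

allow-tallyA-zeroAtA : ∀ v F a → ZeroAtA F a → (∀ a′ → a ≡ suc a′ → ZeroAtA F a′) → ZeroAtA (allow tallyA true v F) a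
allow-tallyA-zeroAtA v F zero    F≗𝟘 below b n = cong (_+ 0) (F≗𝟘 b n)
allow-tallyA-zeroAtA v F (suc a) F≗𝟘 below b n = cong₂ _+_ (F≗𝟘 b n) (shift-vanishes v (below a refl b) n)

allow-free-zeroAtB : ∀ ok v F b → ZeroAtB F b → ZeroAtB (allow free ok v F) b
allow-free-zeroAtB false v F b F≗𝟘     = F≗𝟘
allow-free-zeroAtB true  v F b F≗𝟘 a n = cong₂ _+_ (F≗𝟘 a n) (shift-vanishes v (λ x → F≗𝟘 a x) n)

allow-tallyA-zeroAtB : ∀ ok v F b → ZeroAtB F b → ZeroAtB (allow tallyA ok v F) b
allow-tallyA-zeroAtB false v F b F≗𝟘           = F≗𝟘
allow-tallyA-zeroAtB true  v F b F≗𝟘 zero    n = cong (_+ 0) (F≗𝟘 zero n)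
allow-tallyA-zeroAtB true  v F b F≗𝟘 (suc a) n = cong₂ _+_ (F≗𝟘 (suc a) n) (shift-vanishes v (λ x → F≗𝟘 a x) n)

allow-tallyB-zeroAtB : ∀ v F b → ZeroAtB F b → (∀ b′ → b ≡ suc b′ → ZeroAtB F b′) → ZeroAtB (allow tallyB true v F) b
allow-tallyB-zeroAtB v F zero    F≗𝟘 below a n = cong (_+ 0) (F≗𝟘 a n)
allow-tallyB-zeroAtB v F (suc b) F≗𝟘 below a n = cong₂ _+_ (F≗𝟘 a n) (shift-vanishes v (λ x → below b refl a x) n)

exceeds-pred : ∀ {L A a} → suc L < a ⊎ A < a → L < a ⊎ A < a
exceeds-pred (inj₁ 1+L<a) = inj₁ (<-trans (n<1+n _) 1+L<a)
exceeds-pred (inj₂ A<a)   = inj₂ A<a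

exceeds-below : ∀ {L A a′} → suc L ≤ A → suc L < suc a′ ⊎ A < suc a′ → L < a′
exceeds-below L<A (inj₁ 1+L<1+a′) = ≤-pred 1+L<1+a′
exceeds-below L<A (inj₂ A<1+a′)   = ≤-trans L<A (≤-pred A<1+a′)

≤ᵇ-sound : ∀ {x y} → (x ≤ᵇ y) ≡ true → x ≤ y
≤ᵇ-sound {x} {y} eq = ≤ᵇ⇒≤ x y (subst T (sym eq) _)

block-zeroAtA : ∀ m L okA ok₃ okB ok₆ F a → ZeroAtA F a → (okA ≡ true → ∀ a′ → a ≡ suc a′ → ZeroAtA F a′) →
  ZeroAtA (block m L okA ok₃ okB ok₆ F) a
block-zeroAtA m L okA ok₃ okB ok₆ F a F≗𝟘 below =
  allow-free-zeroAtA ok₆ (6 + 6 * L) _ a (allow-tallyB-zeroAtA okB (3 + m + 6 * L) _ a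
    (allow-free-zeroAtA ok₃ (3 + 6 * L) _ a (tallyA-part okA below)))
  where
  tallyA-part : ∀ okA → (okA ≡ true → ∀ a′ → a ≡ suc a′ → ZeroAtA F a′) → ZeroAtA (allow tallyA okA (m + 6 * L) F) a
  tallyA-part false _     = F≗𝟘
  tallyA-part true  below = allow-tallyA-zeroAtA (m + 6 * L) F a F≗𝟘 (below refl)

block-zeroAtB : ∀ m L okA ok₃ okB ok₆ F b → ZeroAtB F b → (okB ≡ true → ∀ b′ → b ≡ suc b′ → ZeroAtB F b′) →
  ZeroAtB (block m L okA ok₃ okB ok₆ F) b
block-zeroAtB m L okA ok₃ okB ok₆ F b F≗𝟘 below = allow-free-zeroAtB ok₆ (6 + 6 * L) _ b (tallyB-part okB below)
  where
  inner : ∀ b → ZeroAtB F b → ZeroAtB (allow free ok₃ (3 + 6 * L) (allow tallyA okA (m + 6 * L) F)) b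
  inner b F≗𝟘 = allow-free-zeroAtB ok₃ (3 + 6 * L) _ b (allow-tallyA-zeroAtB okA (m + 6 * L) F b F≗𝟘)
  tallyB-part : ∀ okB → (okB ≡ true → ∀ b′ → b ≡ suc b′ → ZeroAtB F b′) →
    ZeroAtB (allow tallyB okB (3 + m + 6 * L) (allow free ok₃ (3 + 6 * L) (allow tallyA okA (m + 6 * L) F))) b
  tallyB-part false _     = inner b F≗𝟘
  tallyB-part true  below =
    allow-tallyB-zeroAtB (3 + m + 6 * L) _ b (inner b F≗𝟘) (λ b′ b≡1+b′ → inner b′ (below refl b′ b≡1+b′))

DIIgf-zeroAtA : ∀ m L A B Γ a → L < a ⊎ A < a → ZeroAtA (DIIgf m L A B Γ) a
DIIgf-zeroAtA m zero    A B Γ zero    (inj₁ ())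
DIIgf-zeroAtA m zero    A B Γ zero    (inj₂ ())
DIIgf-zeroAtA m zero    A B Γ (suc a) _ zero    n = refl
DIIgf-zeroAtA m zero    A B Γ (suc a) _ (suc b) n = refl
DIIgf-zeroAtA m (suc L) A B Γ a exceeds =
  block-zeroAtA m L (suc L ≤ᵇ A) (suc (2 * L) ≤ᵇ Γ) (suc L ≤ᵇ B) (suc (suc (2 * L)) ≤ᵇ Γ) (DIIgf m L A B Γ) a
    (DIIgf-zeroAtA m L A B Γ a (exceeds-pred exceeds))
    (λ { 1+L≤A a′ refl → DIIgf-zeroAtA m L A B Γ a′ (inj₁ (exceeds-below (≤ᵇ-sound 1+L≤A) exceeds)) })

DIIgf-zeroAtB : ∀ m L A B Γ b → L < b ⊎ B < b → ZeroAtB (DIIgf m L A B Γ) b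
DIIgf-zeroAtB m zero    A B Γ zero    (inj₁ ())
DIIgf-zeroAtB m zero    A B Γ zero    (inj₂ ())
DIIgf-zeroAtB m zero    A B Γ (suc b) _ zero    n = refl
DIIgf-zeroAtB m zero    A B Γ (suc b) _ (suc a) n = refl
DIIgf-zeroAtB m (suc L) A B Γ b exceeds =
  block-zeroAtB m L (suc L ≤ᵇ A) (suc (2 * L) ≤ᵇ Γ) (suc L ≤ᵇ B) (suc (suc (2 * L)) ≤ᵇ Γ) (DIIgf m L A B Γ) b
    (DIIgf-zeroAtB m L A B Γ b (exceeds-pred exceeds))
    (λ { 1+L≤B b′ refl → DIIgf-zeroAtB m L A B Γ b′ (inj₁ (exceeds-below (≤ᵇ-sound 1+L≤B) exceeds)) })

DIIgf-empty : ∀ m L → DIIgf m L 0 0 0 ≈ 𝟙₂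
DIIgf-empty m zero    = ≈-refl
DIIgf-empty m (suc L) = DIIgf-empty m L

-- The closed form

triangle : ℕ → ℕ
triangle zero    = 0
triangle (suc k) = triangle k + k

-- Σ_{s<i} (6s + m) + Σ_{t<j} (6t + m + 3): the least sum of i parts ≡ m and j parts ≡ m + 3 mod 6.
offset : ℕ → ℕ → ℕ → ℕ
offset m i j = 6 * triangle i + m * i + (6 * triangle j + (m + 3) * j)

offset-sucⁱ : ∀ m i j → offset m (suc i) j ≡ offset m i j + (6 * i + m)
offset-sucⁱ m i j = lemma (triangle i) (triangle j) m i j
  where
  lemma : ∀ tᵢ tⱼ m i j → 6 * (tᵢ + i) + m * suc i + (6 * tⱼ + (m + 3) * j) ≡ 6 * tᵢ + m * i + (6 * tⱼ + (m + 3) * j) + (6 * i + m)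
  lemma = solve-∀

offset-sucʲ : ∀ m i j → offset m i (suc j) ≡ offset m i j + (6 * j + m + 3)
offset-sucʲ m i j = lemma (triangle i) (triangle j) m i j
  where
  lemma : ∀ tᵢ tⱼ m i j → 6 * tᵢ + m * i + (6 * (tⱼ + j) + (m + 3) * suc j) ≡ 6 * tᵢ + m * i + (6 * tⱼ + (m + 3) * j) + (6 * j + m + 3)
  lemma = solve-∀

offset-swap : ∀ m i j → offset m i j + 3 * i ≡ offset m j i + 3 * j
offset-swap m i j = lemma (triangle i) (triangle j) m i j
  where
  lemma : ∀ tᵢ tⱼ m i j → 6 * tᵢ + m * i + (6 * tⱼ + (m + 3) * j) + 3 * i ≡ 6 * tⱼ + m * j + (6 * tᵢ + (m + 3) * i) + 3 * j
  lemma = solve-∀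

offset-origin : ∀ m → offset m 0 0 ≡ 0
offset-origin m = lemma m
  where
  lemma : ∀ m → 6 * 0 + m * 0 + (6 * 0 + (m + 3) * 0) ≡ 0
  lemma = solve-∀

G-origin : G 0 0 0 ≗ 𝟙
G-origin n = trans (+-identityʳ _) (trans (+-identityʳ _) (+-identityʳ _))

offsetG : ℕ → ℕ → ℕ → ℕ → Series
offsetG m i j r = shift (offset m i j) (G i j r)

base-pos : ∀ i j r N → suc N ≡ i + j + r → base i j r ≗ 𝟘
base-pos zero    zero    zero    N () n
base-pos zero    zero    (suc r) N _  n = refl
base-pos zero    (suc j) r       N _  n = refl
base-pos (suc i) j       r       N _  n = refl

-- With A = i + j + r, B = j + r and Γ = r, raising A, B and Γ one at a time produces the three terms of
-- the defining recurrence of G.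
module _ (m L : ℕ) where

  private
    Tᵢ Tⱼ Tᵣ : ℕ → ℕ → ℕ → Series
    Tᵢ i j r = shift (offset m i j) (Gᵢ i j r)
    Tⱼ i j r = shift (offset m i j) (Gⱼ i j r)
    Tᵣ i j r = shift (offset m i j) (Gᵣ i j r)

  mutual
    DIIgf-closed : ∀ i j r → i + j + r ≤ L → DIIgf m L (i + j + r) (j + r) r i j ≗ offsetG m i j r
    DIIgf-closed zero    zero    zero    _  n =
      trans (DIIgf-empty m L 0 0 n) (sym (trans (cong (λ k → shift k (G 0 0 0) n) (offset-origin m)) (G-origin n)))
    DIIgf-closed (suc i) j       r       le = DIIgf-closed-pos (suc i) j r (i + j + r) refl le
    DIIgf-closed zero    (suc j) r       le = DIIgf-closed-pos zero (suc j) r (j + r) refl le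
    DIIgf-closed zero    zero    (suc r) le = DIIgf-closed-pos zero zero (suc r) r refl le

    DIIgf-closed-pos : ∀ i j r N → suc N ≡ i + j + r → i + j + r ≤ L → DIIgf m L (i + j + r) (j + r) r i j ≗ offsetG m i j r
    DIIgf-closed-pos i j r N eq le n = begin
      DIIgf m L (i + j + r) (j + r) r i j n
        ≡⟨ cong (λ A → DIIgf m L A (j + r) r i j n) (sym eq) ⟩
      DIIgf m L (suc N) (j + r) r i j n
        ≡⟨ peelA i j r N eq 1+N≤L n ⟩
      DIIgf m L N (j + r) r i j n + Tᵢ i j r n
        ≡⟨ cong (_+ Tᵢ i j r n) (peelBΓ i j r N eq 1+N≤L n) ⟩
      Tⱼ i j r n + Tᵣ i j r n + Tᵢ i j r n
        ≡⟨ rotate (Tⱼ i j r n) (Tᵣ i j r n) (Tᵢ i j r n) ⟩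
      0 + Tᵢ i j r n + Tⱼ i j r n + Tᵣ i j r n
        ≡⟨ cong (λ x → x + Tᵢ i j r n + Tⱼ i j r n + Tᵣ i j r n) (sym (shift-vanishes (offset m i j) (base-pos i j r N eq) n)) ⟩
      shift (offset m i j) (base i j r) n + Tᵢ i j r n + Tⱼ i j r n + Tᵣ i j r n
        ≡⟨ sym (shift-⊕₄ (offset m i j) (base i j r) (Gᵢ i j r) (Gⱼ i j r) (Gᵣ i j r) n) ⟩
      offsetG m i j r n
        ∎
      where
      open ≡-Reasoning
      1+N≤L : suc N ≤ L
      1+N≤L = subst (_≤ L) (sym eq) le
      rotate : ∀ a b c → a + b + c ≡ 0 + c + a + b
      rotate = solve-∀

    peelA : ∀ i j r N → suc N ≡ i + j + r → suc N ≤ L →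
      DIIgf m L (suc N) (j + r) r i j ≗ DIIgf m L N (j + r) r i j ⊕ Tᵢ i j r
    peelA zero    j r N eq le n =
      trans (DIIgf-sucA m L N (j + r) r le zero j n) (cong (DIIgf m L N (j + r) r zero j n +_) (sym (shift-𝟘 (offset m 0 j) n)))
    peelA (suc i) j r N eq le n =
      trans (DIIgf-sucA m L N (j + r) r le (suc i) j n)
        (cong (DIIgf m L N (j + r) r (suc i) j n +_) (begin
          shift (m + 6 * N) (DIIgf m L N (j + r) r i j) n
            ≡⟨ shift-cong (m + 6 * N) (λ x → trans (cong (λ A → DIIgf m L A (j + r) r i j x) N≡)
                                                   (DIIgf-closed i j r (≤-trans (≤-reflexive (sym N≡)) (<⇒≤ le)) x)) n ⟩
          shift (m + 6 * N) (offsetG m i j r) n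
            ≡⟨ shift-regroup (m + 6 * N) (offset m i j) (offset m (suc i) j) (6 * (j + r)) (G i j r) exponents n ⟩
          Tᵢ (suc i) j r n
            ∎))
      where
      open ≡-Reasoning
      N≡ : N ≡ i + j + r
      N≡ = suc-injective eq
      exponents : m + 6 * N + offset m i j ≡ offset m (suc i) j + 6 * (j + r)
      exponents = begin
        m + 6 * N + offset m i j               ≡⟨ cong (λ N → m + 6 * N + offset m i j) N≡ ⟩
        m + 6 * (i + j + r) + offset m i j     ≡⟨ lemma (offset m i j) m i j r ⟩
        offset m i j + (6 * i + m) + 6 * (j + r) ≡⟨ cong (_+ 6 * (j + r)) (sym (offset-sucⁱ m i j)) ⟩
        offset m (suc i) j + 6 * (j + r)       ∎
        where
        lemma : ∀ o m i j r → m + 6 * (i + j + r) + o ≡ o + (6 * i + m) + 6 * (j + r)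
        lemma = solve-∀

    peelBΓ : ∀ i j r N → suc N ≡ i + j + r → suc N ≤ L → DIIgf m L N (j + r) r i j ≗ Tⱼ i j r ⊕ Tᵣ i j r
    peelBΓ i zero zero N eq le n =
      trans (DIIgf-zeroAtA m L N 0 0 i (inj₂ N<i) zero n)
            (sym (cong₂ _+_ (shift-𝟘 (offset m i 0) n) (shift-𝟘 (offset m i 0) n)))
      where
      N<i : N < i
      N<i = ≤-reflexive (trans eq (trans (+-identityʳ (i + 0)) (+-identityʳ i)))
    peelBΓ i (suc j) r N eq le n =
      trans (peelB i (suc j) r N (j + r) eq refl le n)
            (trans (cong (_+ Tⱼ i (suc j) r n) (peelΓ i (suc j) r N (j + r) eq refl le n)) (+-comm (Tᵣ i (suc j) r n) (Tⱼ i (suc j) r n)))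
    peelBΓ i zero (suc r) N eq le n =
      trans (peelB i zero (suc r) N r eq refl le n)
            (trans (cong (_+ Tⱼ i zero (suc r) n) (peelΓ i zero (suc r) N r eq refl le n)) (+-comm (Tᵣ i zero (suc r) n) (Tⱼ i zero (suc r) n)))

    peelB : ∀ i j r N M → suc N ≡ i + j + r → suc M ≡ j + r → suc N ≤ L →
      DIIgf m L N (suc M) r i j ≗ DIIgf m L N M r i j ⊕ Tⱼ i j r
    peelB i j r N M eq eqM le n with DIIgf-sucB m L N M r (≤-trans (s≤s M≤N) le) i j n
      where
      M≤N : M ≤ N
      M≤N = ≤-pred (subst₂ _≤_ (sym eqM) (sym eq) (≤-trans (m≤n+m (j + r) i) (≤-reflexive (sym (+-assoc i j r)))))
    peelB i zero    r N M eq eqM le n | step = trans step (cong (DIIgf m L N M r i 0 n +_) (sym (shift-𝟘 (offset m i 0) n)))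
    peelB i (suc j) r N M eq eqM le n | step =
      trans step (cong (DIIgf m L N M r i (suc j) n +_) (begin
        shift (3 + m + 6 * M) (DIIgf m L N M r i j) n
          ≡⟨ shift-cong (3 + m + 6 * M) (λ x → trans (cong₂ (λ A B → DIIgf m L A B r i j x) N≡ M≡)
                                                      (DIIgf-closed i j r (≤-trans (≤-reflexive (sym N≡)) (<⇒≤ le)) x)) n ⟩
        shift (3 + m + 6 * M) (offsetG m i j r) n
          ≡⟨ shift-regroup (3 + m + 6 * M) (offset m i j) (offset m i (suc j)) (6 * r) (G i j r) exponents n ⟩
        Tⱼ i (suc j) r n
          ∎))
      where
      open ≡-Reasoning
      N≡ : N ≡ i + j + r
      N≡ = suc-injective (trans eq (+-suc-middle i j r))
        where
        +-suc-middle : ∀ i j r → i + suc j + r ≡ suc (i + j + r)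
        +-suc-middle = solve-∀
      M≡ : M ≡ j + r
      M≡ = suc-injective eqM
      exponents : 3 + m + 6 * M + offset m i j ≡ offset m i (suc j) + 6 * r
      exponents = begin
        3 + m + 6 * M + offset m i j                 ≡⟨ cong (λ M → 3 + m + 6 * M + offset m i j) M≡ ⟩
        3 + m + 6 * (j + r) + offset m i j           ≡⟨ lemma (offset m i j) m j r ⟩
        offset m i j + (6 * j + m + 3) + 6 * r       ≡⟨ cong (_+ 6 * r) (sym (offset-sucʲ m i j)) ⟩
        offset m i (suc j) + 6 * r                   ∎
        where
        lemma : ∀ o m j r → 3 + m + 6 * (j + r) + o ≡ o + (6 * j + m + 3) + 6 * r
        lemma = solve-∀

    peelΓ : ∀ i j r N M → suc N ≡ i + j + r → suc M ≡ j + r → suc N ≤ L → DIIgf m L N M r i j ≗ Tᵣ i j r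
    peelΓ i j zero N M eq eqM le n =
      trans (DIIgf-zeroAtB m L N M 0 j (inj₂ (≤-reflexive (trans eqM (+-identityʳ j)))) i n) (sym (shift-𝟘 (offset m i j) n))
    peelΓ i j (suc r) N M eq eqM le n = begin
      DIIgf m L N M (suc r) i j n
        ≡⟨ DIIgf-sucΓ m L N M r (≤-trans (s≤s r≤N) (≤-trans le (m≤n*m L 2))) i j n ⟩
      DIIgf m L N M r i j n + shift (3 + 3 * r) (DIIgf m L N M r i j) n
        ≡⟨ cong₂ _+_ (closed n) (trans (shift-cong (3 + 3 * r) closed n) (cong (λ k → shift k (offsetG m i j r) n) (sym (*-suc 3 r)))) ⟩
      offsetG m i j r n + shift (3 * suc r) (offsetG m i j r) n
        ≡⟨ cong (offsetG m i j r n +_) (shift-comm (3 * suc r) (offset m i j) (G i j r) n) ⟩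
      offsetG m i j r n + shift (offset m i j) (shift (3 * suc r) (G i j r)) n
        ≡⟨ sym (shift-⊕ (offset m i j) (G i j r) (shift (3 * suc r) (G i j r)) n) ⟩
      Tᵣ i j (suc r) n
        ∎
      where
      open ≡-Reasoning
      N≡ : N ≡ i + j + r
      N≡ = suc-injective (trans eq (+-suc (i + j) r))
      M≡ : M ≡ j + r
      M≡ = suc-injective (trans eqM (+-suc j r))
      r≤N : r ≤ N
      r≤N = subst (r ≤_) (sym N≡) (m≤n+m r (i + j))
      closed : DIIgf m L N M r i j ≗ offsetG m i j r
      closed x = trans (cong₂ (λ A B → DIIgf m L A B r i j x) N≡ M≡) (DIIgf-closed i j r (≤-trans (≤-reflexive (sym N≡)) (<⇒≤ le)) x)

closedForm : ℕ → ℕ → Fam₂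
closedForm m N i j = if i + j ≤ᵇ N then offsetG m i j (N ∸ (i + j)) else 𝟘

closedForm-at : ∀ m N i j r → i + j + r ≡ N → closedForm m N i j ≗ offsetG m i j r
closedForm-at m N i j r refl n rewrite ≤ᵇ-true (m≤m+n (i + j) r) | m+n∸m≡n (i + j) r = refl

closedForm-above : ∀ m N i j → N < i + j → closedForm m N i j ≗ 𝟘
closedForm-above m N i j N<i+j n rewrite ≤ᵇ-false N<i+j = refl

module _ (m N : ℕ) where

  private
    F = closedForm m N
    marked : Fam₂
    marked = lower tallyA (m + 3 * N) (λ a b → F b a)

  marked-above : ∀ i j → suc N < i + j → marked i j ≗ 𝟘
  marked-above zero    j _   n = refl
  marked-above (suc i) j N+1<i+j+1 =
    shift-vanishes (m + 3 * N) (closedForm-above m N j i (subst (N <_) (+-comm i j) (≤-pred N+1<i+j+1)))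

  offset-base : ∀ i j r → i + j + r ≡ suc N → shift (offset m i j) (base i j r) ≗ 𝟘
  offset-base i j r eq = shift-vanishes (offset m i j) (base-pos i j r N (sym eq))

  offset-Iˣ : ∀ i j r → i + j + r ≡ suc N → shift (offset m i j) (Iˣ G i j r) ≗ marked i j
  offset-Iˣ zero    j r eq = shift-𝟘 (offset m 0 j)
  offset-Iˣ (suc i) j r eq n = begin
    shift (offset m (suc i) j) (shift (3 * r) (G j i r)) n
      ≡⟨ shift-regroup (offset m (suc i) j) (3 * r) (m + 3 * N) (offset m j i) (G j i r) exponents n ⟩
    shift (m + 3 * N) (offsetG m j i r) n
      ≡⟨ shift-cong (m + 3 * N) (λ x → sym (closedForm-at m N j i r N≡ x)) n ⟩
    marked (suc i) j n
      ∎
    where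
    open ≡-Reasoning
    N≡ : j + i + r ≡ N
    N≡ = suc-injective (trans (lemma j i r) eq)
      where
      lemma : ∀ j i r → suc (j + i + r) ≡ suc i + j + r
      lemma = solve-∀
    exponents : offset m (suc i) j + 3 * r ≡ m + 3 * N + offset m j i
    exponents = begin
      offset m (suc i) j + 3 * r               ≡⟨ cong (_+ 3 * r) (offset-sucⁱ m i j) ⟩
      offset m i j + (6 * i + m) + 3 * r       ≡⟨ lemma₁ (offset m i j) m i r ⟩
      offset m i j + 3 * i + (3 * i + m + 3 * r) ≡⟨ cong (_+ (3 * i + m + 3 * r)) (offset-swap m i j) ⟩
      offset m j i + 3 * j + (3 * i + m + 3 * r) ≡⟨ lemma₂ (offset m j i) m i j r ⟩
      m + 3 * (j + i + r) + offset m j i       ≡⟨ cong (λ k → m + 3 * k + offset m j i) N≡ ⟩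
      m + 3 * N + offset m j i                 ∎
      where
      lemma₁ : ∀ o m i r → o + (6 * i + m) + 3 * r ≡ o + 3 * i + (3 * i + m + 3 * r)
      lemma₁ = solve-∀
      lemma₂ : ∀ o m i j r → o + 3 * j + (3 * i + m + 3 * r) ≡ m + 3 * (j + i + r) + o
      lemma₂ = solve-∀

  offset-Jˡ : ∀ i j r → i + j + r ≡ suc N → shift (offset m i j) (Jˡ G i j r) ≗ shift (3 + 3 * N) (marked j i)
  offset-Jˡ i zero    r eq n = trans (shift-𝟘 (offset m i 0) n) (sym (shift-𝟘 (3 + 3 * N) n))
  offset-Jˡ i (suc j) r eq n = begin
    shift (offset m i (suc j)) (shift (6 * (i + r)) (G i j r)) n
      ≡⟨ shift-regroup (offset m i (suc j)) (6 * (i + r)) (3 + 3 * N) (m + 3 * N + offset m i j) (G i j r) exponents n ⟩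
    shift (3 + 3 * N) (shift (m + 3 * N + offset m i j) (G i j r)) n
      ≡⟨ shift-cong (3 + 3 * N) (λ x → trans (shift-+ (m + 3 * N) (offset m i j) (G i j r) x)
                                             (shift-cong (m + 3 * N) (λ y → sym (closedForm-at m N i j r N≡ y)) x)) n ⟩
    shift (3 + 3 * N) (marked (suc j) i) n
      ∎
    where
    open ≡-Reasoning
    N≡ : i + j + r ≡ N
    N≡ = suc-injective (trans (lemma i j r) eq)
      where
      lemma : ∀ i j r → suc (i + j + r) ≡ i + suc j + r
      lemma = solve-∀
    exponents : offset m i (suc j) + 6 * (i + r) ≡ 3 + 3 * N + (m + 3 * N + offset m i j)
    exponents = begin
      offset m i (suc j) + 6 * (i + r)              ≡⟨ cong (_+ 6 * (i + r)) (offset-sucʲ m i j) ⟩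
      offset m i j + (6 * j + m + 3) + 6 * (i + r)  ≡⟨ lemma (offset m i j) m i j r ⟩
      3 + 3 * (i + j + r) + (m + 3 * (i + j + r) + offset m i j)
                                                    ≡⟨ cong (λ k → 3 + 3 * k + (m + 3 * k + offset m i j)) N≡ ⟩
      3 + 3 * N + (m + 3 * N + offset m i j)        ∎
      where
      lemma : ∀ o m i j r → o + (6 * j + m + 3) + 6 * (i + r) ≡ 3 + 3 * (i + j + r) + (m + 3 * (i + j + r) + o)
      lemma = solve-∀

  offset-Rˣ : ∀ i j r → i + j + r ≡ suc N → shift (offset m i j) (Rˣ G i j r) ≗ F i j ⊕ shift (3 + 3 * N) (F j i)
  offset-Rˣ i j zero eq n = begin
    shift (offset m i j) 𝟘 n
      ≡⟨ shift-𝟘 (offset m i j) n ⟩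
    0
      ≡⟨ sym (cong₂ _+_ (closedForm-above m N i j N<i+j n)
                        (shift-vanishes (3 + 3 * N) (closedForm-above m N j i (subst (N <_) (+-comm i j) N<i+j)) n)) ⟩
    F i j n + shift (3 + 3 * N) (F j i) n
      ∎
    where
    open ≡-Reasoning
    N<i+j : N < i + j
    N<i+j = ≤-reflexive (sym (trans (sym (+-identityʳ (i + j))) eq))
  offset-Rˣ i j (suc r) eq n = begin
    shift (offset m i j) (G i j r ⊕ shift (3 * suc r + 6 * i) (G j i r)) n
      ≡⟨ shift-⊕ (offset m i j) (G i j r) (shift (3 * suc r + 6 * i) (G j i r)) n ⟩
    offsetG m i j r n + shift (offset m i j) (shift (3 * suc r + 6 * i) (G j i r)) n
      ≡⟨ cong (offsetG m i j r n +_) (shift-regroup (offset m i j) (3 * suc r + 6 * i) (3 + 3 * N) (offset m j i) (G j i r) exponents n) ⟩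
    offsetG m i j r n + shift (3 + 3 * N) (offsetG m j i r) n
      ≡⟨ sym (cong₂ _+_ (closedForm-at m N i j r N≡ n) (shift-cong (3 + 3 * N) (closedForm-at m N j i r (trans (cong (_+ r) (+-comm j i)) N≡)) n)) ⟩
    F i j n + shift (3 + 3 * N) (F j i) n
      ∎
    where
    open ≡-Reasoning
    N≡ : i + j + r ≡ N
    N≡ = suc-injective (trans (sym (+-suc (i + j) r)) eq)
    exponents : offset m i j + (3 * suc r + 6 * i) ≡ 3 + 3 * N + offset m j i
    exponents = begin
      offset m i j + (3 * suc r + 6 * i)          ≡⟨ lemma₁ (offset m i j) i r ⟩
      offset m i j + 3 * i + (3 * suc r + 3 * i)  ≡⟨ cong (_+ (3 * suc r + 3 * i)) (offset-swap m i j) ⟩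
      offset m j i + 3 * j + (3 * suc r + 3 * i)  ≡⟨ lemma₂ (offset m j i) i j r ⟩
      3 + 3 * (i + j + r) + offset m j i          ≡⟨ cong (λ k → 3 + 3 * k + offset m j i) N≡ ⟩
      3 + 3 * N + offset m j i                    ∎
      where
      lemma₁ : ∀ o i r → o + (3 * suc r + 6 * i) ≡ o + 3 * i + (3 * suc r + 3 * i)
      lemma₁ = solve-∀
      lemma₂ : ∀ o i j r → o + 3 * j + (3 * suc r + 3 * i) ≡ 3 + 3 * (i + j + r) + o
      lemma₂ = solve-∀

  -- Multiplying the star recurrence of G by q^{offset} gives the recurrence of D^I in N.
  closedForm-suc : closedForm m (suc N) ≈ swapPart (3 + 3 * N) (swapCountPart (m + 3 * N) F)
  closedForm-suc i j n with i + j ≤? suc N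
  ... | no  i+j≰N+1 = begin
    closedForm m (suc N) i j n
      ≡⟨ closedForm-above m (suc N) i j (≰⇒> i+j≰N+1) n ⟩
    0
      ≡⟨ sym (cong₂ _+_ (cong₂ _+_ (closedForm-above m N i j N<i+j n) (marked-above i j (≰⇒> i+j≰N+1) n))
                        (shift-vanishes (3 + 3 * N) (λ x → cong₂ _+_ (closedForm-above m N j i N<j+i x)
                                                                     (marked-above j i N+1<j+i x)) n)) ⟩
    swapPart (3 + 3 * N) (swapCountPart (m + 3 * N) F) i j n
      ∎
    where
    open ≡-Reasoning
    N<i+j : N < i + j
    N<i+j = <-trans (n<1+n N) (≰⇒> i+j≰N+1)
    N<j+i : N < j + i
    N<j+i = subst (N <_) (+-comm i j) N<i+j
    N+1<j+i : suc N < j + i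
    N+1<j+i = subst (suc N <_) (+-comm i j) (≰⇒> i+j≰N+1)
  ... | yes i+j≤N+1 with m≤n⇒∃[o]m+o≡n i+j≤N+1
  ... | r , eq = begin
    closedForm m (suc N) i j n
      ≡⟨ closedForm-at m (suc N) i j r eq n ⟩
    shift (offset m i j) (G i j r) n
      ≡⟨ shift-cong (offset m i j) (G-star i j r) n ⟩
    shift (offset m i j) (base i j r ⊕ Iˣ G i j r ⊕ Jˡ G i j r ⊕ Rˣ G i j r) n
      ≡⟨ shift-⊕₄ (offset m i j) (base i j r) (Iˣ G i j r) (Jˡ G i j r) (Rˣ G i j r) n ⟩
    _ ≡⟨ +-cong₄ (offset-base i j r eq n) (offset-Iˣ i j r eq n) (offset-Jˡ i j r eq n) (offset-Rˣ i j r eq n) ⟩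
    0 + marked i j n + shift (3 + 3 * N) (marked j i) n + (F i j n + shift (3 + 3 * N) (F j i) n)
      ≡⟨ regroup (marked i j n) (shift (3 + 3 * N) (marked j i) n) (F i j n) (shift (3 + 3 * N) (F j i) n) ⟩
    (F i j n + marked i j n) + (shift (3 + 3 * N) (F j i) n + shift (3 + 3 * N) (marked j i) n)
      ≡⟨ cong (F i j n + marked i j n +_) (sym (shift-⊕ (3 + 3 * N) (F j i) (marked j i) n)) ⟩
    swapPart (3 + 3 * N) (swapCountPart (m + 3 * N) F) i j n
      ∎
    where
    open ≡-Reasoning
    regroup : ∀ x y a b → 0 + x + y + (a + b) ≡ (a + x) + (b + y)
    regroup = solve-∀

-- D^I and D^II

countL-dparts-large : ∀ (q : List ℕ → Bool) k n → n ≤ k → countL q (dparts k n) ≡ countL q (dparts n n)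
countL-dparts-large q k n n≤k with m≤n⇒m<n∨m≡n n≤k
... | inj₂ refl = refl
countL-dparts-large q (suc k) n n≤k | inj₁ n<1+k =
  trans (countL-dparts-suc q k n)
        (trans (cong (countL q (dparts k n) +_) (shift-below (suc k) _ n<1+k))
               (trans (+-identityʳ _) (countL-dparts-large q k n (≤-pred n<1+k))))

countL-dparts-bounded : ∀ K (q : List ℕ → Bool) k n →
  countL (λ π → allB (_≤ᵇ K) π ∧ q π) (dparts k n) ≡ countL q (dparts (k ⊓ K) n)
countL-dparts-bounded K q zero zero    = refl
countL-dparts-bounded K q zero (suc n) = refl
countL-dparts-bounded K q (suc k) n with suc k ≤? K
... | yes 1+k≤K rewrite m≤n⇒m⊓n≡m 1+k≤K = begin
  countL bounded (dparts (suc k) n)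
    ≡⟨ countL-dparts-suc bounded k n ⟩
  countL bounded (dparts k n) + shift (suc k) (λ n′ → countL (λ π → bounded (suc k ∷ π)) (dparts k n′)) n
    ≡⟨ cong₂ _+_ (below q) (shift-cong (suc k) (λ n′ → trans (countL-cong (λ π → cong (λ b → (b ∧ allB (_≤ᵇ K) π) ∧ q (suc k ∷ π)) (≤ᵇ-true 1+k≤K)) (dparts k n′))
                                                          (below′ n′)) n) ⟩
  countL q (dparts k n) + shift (suc k) (λ n′ → countL (λ π → q (suc k ∷ π)) (dparts k n′)) n
    ≡⟨ sym (countL-dparts-suc q k n) ⟩
  countL q (dparts (suc k) n)
    ∎
  where
  open ≡-Reasoning
  bounded : List ℕ → Bool
  bounded π = allB (_≤ᵇ K) π ∧ q π
  k⊓K≡k : k ⊓ K ≡ k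
  k⊓K≡k = m≤n⇒m⊓n≡m (<⇒≤ 1+k≤K)
  below : ∀ q → countL (λ π → allB (_≤ᵇ K) π ∧ q π) (dparts k n) ≡ countL q (dparts k n)
  below q = trans (countL-dparts-bounded K q k n) (cong (λ k′ → countL q (dparts k′ n)) k⊓K≡k)
  below′ : ∀ n′ → countL (λ π → allB (_≤ᵇ K) π ∧ q (suc k ∷ π)) (dparts k n′) ≡ countL (λ π → q (suc k ∷ π)) (dparts k n′)
  below′ n′ = trans (countL-dparts-bounded K (λ π → q (suc k ∷ π)) k n′) (cong (λ k′ → countL _ (dparts k′ n′)) k⊓K≡k)
... | no 1+k≰K rewrite m≥n⇒m⊓n≡n (<⇒≤ (≰⇒> 1+k≰K)) = begin
  countL bounded (dparts (suc k) n)
    ≡⟨ countL-dparts-suc bounded k n ⟩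
  countL bounded (dparts k n) + shift (suc k) (λ n′ → countL (λ π → bounded (suc k ∷ π)) (dparts k n′)) n
    ≡⟨ cong (countL bounded (dparts k n) +_)
            (shift-vanishes (suc k) (λ n′ → trans (countL-cong (λ π → cong (λ b → (b ∧ allB (_≤ᵇ K) π) ∧ q (suc k ∷ π)) (≤ᵇ-false (≰⇒> 1+k≰K))) (dparts k n′))
                                                  (countL-false (dparts k n′))) n) ⟩
  countL bounded (dparts k n) + 0
    ≡⟨ +-identityʳ _ ⟩
  countL bounded (dparts k n)
    ≡⟨ countL-dparts-bounded K q k n ⟩
  countL q (dparts (k ⊓ K) n)
    ≡⟨ cong (λ k′ → countL q (dparts k′ n)) (m≥n⇒m⊓n≡n (≤-pred (≰⇒> 1+k≰K))) ⟩
  countL q (dparts K n)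
    ∎
  where
  open ≡-Reasoning
  bounded : List ℕ → Bool
  bounded π = allB (_≤ᵇ K) π ∧ q π

countL-bounded : ∀ K (q : List ℕ → Bool) n → countL (λ π → allB (_≤ᵇ K) π ∧ q π) (DistinctPartitions n) ≡ countL q (dparts K n)
countL-bounded K q n with n ≤? K
... | yes n≤K = trans (countL-dparts-bounded K q n n) (trans (cong (λ k → countL q (dparts k n)) (m≤n⇒m⊓n≡m n≤K))
                                                            (sym (countL-dparts-large q K n n≤K)))
... | no  n≰K = trans (countL-dparts-bounded K q n n) (cong (λ k → countL q (dparts k n)) (m≥n⇒m⊓n≡n (<⇒≤ (≰⇒> n≰K))))

∧-swapʳ : ∀ a b c → a ∧ (b ∧ c) ≡ a ∧ (c ∧ b)
∧-swapʳ a b c = cong (a ∧_) (∧-comm b c)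

∧-swapˡ : ∀ a b c → a ∧ (b ∧ c) ≡ b ∧ (a ∧ c)
∧-swapˡ true  b c = refl
∧-swapˡ false b c = sym (∧-zeroʳ b)

-- The condition of D^I without the bound; prepending a part turns odd positions into even ones, so the
-- two statistics i and j exchange their roles.
PI : ℕ → PFam
PI m i j []      = (0 ≡ᵇ i) ∧ (0 ≡ᵇ j)
PI m i j (x ∷ π) = notNegM m x ∧ (if x % 3 ≡ᵇ m then onPred i (λ i′ → PI m j i′ π) else PI m j i π)

markedCount : ℕ → (List ℕ → List ℕ) → List ℕ → ℕ
markedCount m positions π = countB (λ p → p % 3 ≡ᵇ m) (positions π)

PI-correct : ∀ m π i j →
  allB (notNegM m) π ∧ ((markedCount m oddIndexed π ≡ᵇ i) ∧ (markedCount m evenIndexed π ≡ᵇ j)) ≡ PI m i j π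
PI-correct m []      i j = refl
PI-correct m (x ∷ π) i j with notNegM m x | x % 3 ≡ᵇ m
... | false | _     = refl
... | true  | true  with i
...   | zero   = ∧-zeroʳ _
...   | suc i′ = trans (∧-swapʳ (allB (notNegM m) π) (markedCount m evenIndexed π ≡ᵇ i′) (markedCount m oddIndexed π ≡ᵇ j)) (PI-correct m π j i′)
PI-correct m (x ∷ π) i j | true | false = trans (∧-swapʳ (allB (notNegM m) π) (markedCount m evenIndexed π ≡ᵇ i) (markedCount m oddIndexed π ≡ᵇ j)) (PI-correct m π j i)

DI-count : ∀ m N i j n → DI m N i j n ≡ count (PI m) (3 * N) i j n
DI-count m N i j n =
  trans (countL-cong (λ π → trans (∧-swapˡ (allB (notNegM m) π) (allB (_≤ᵇ 3 * N) π) _)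
                                  (cong (allB (_≤ᵇ 3 * N) π ∧_) (PI-correct m π i j))) (DistinctPartitions n))
        (countL-bounded (3 * N) (PI m i j) n)

residue₃ : ∀ s N → (s + 3 * N) % 3 ≡ s % 3
residue₃ s N = trans (cong (λ k → (s + k) % 3) (*-comm 3 N)) ([m+kn]%n≡m%n s N 3)

PI-free : ∀ m x → notNegM m x ≡ true → (x % 3 ≡ᵇ m) ≡ false → ∀ i j π → PI m i j (x ∷ π) ≡ PI m j i π
PI-free m x allowed unmarked i j π rewrite allowed | unmarked = refl

PI-marked : ∀ m x → notNegM m x ≡ true → (x % 3 ≡ᵇ m) ≡ true → ∀ i j π → PI m i j (x ∷ π) ≡ onPred i (λ i′ → PI m j i′ π)
PI-marked m x allowed marked i j π rewrite allowed | marked = refl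

PI-excluded : ∀ m x → notNegM m x ≡ false → ∀ i j π → PI m i j (x ∷ π) ≡ false
PI-excluded m x excluded i j π rewrite excluded = refl

-- The parts in (3N, 3N + 3]: 3N + 3 is unmarked, 3N + m is marked and 3N + 3 − m is excluded.
DI-block : ∀ m → m ≡ 1 ⊎ m ≡ 2 → ∀ N →
  count (PI m) (3 * suc N) ≈ swapPart (3 + 3 * N) (swapCountPart (m + 3 * N) (count (PI m) (3 * N)))
DI-block m m∈ N a b n =
  trans (cong (λ k → count (PI m) k a b n) (*-suc 3 N))
        (trans (count-swap (PI m) (2 + 3 * N) top a b n) (swapPart-cong (3 + 3 * N) (lower-two m∈) a b n))
  where
  mod₃ : ∀ s → (s + 3 * N) % 3 ≡ s % 3
  mod₃ s = residue₃ s N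
  top : ∀ i j π → PI m i j (3 + 3 * N ∷ π) ≡ PI m j i π
  top = PI-free m (3 + 3 * N) (allowed m∈) (unmarked m∈)
    where
    allowed : m ≡ 1 ⊎ m ≡ 2 → notNegM m (3 + 3 * N) ≡ true
    allowed (inj₁ refl) = cong (λ z → not (z ≡ᵇ 2)) (mod₃ 3)
    allowed (inj₂ refl) = cong (λ z → not (z ≡ᵇ 1)) (mod₃ 3)
    unmarked : m ≡ 1 ⊎ m ≡ 2 → ((3 + 3 * N) % 3 ≡ᵇ m) ≡ false
    unmarked (inj₁ refl) = cong (_≡ᵇ 1) (mod₃ 3)
    unmarked (inj₂ refl) = cong (_≡ᵇ 2) (mod₃ 3)
  lower-two : m ≡ 1 ⊎ m ≡ 2 → count (PI m) (2 + 3 * N) ≈ swapCountPart (m + 3 * N) (count (PI m) (3 * N))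
  lower-two (inj₁ refl) =
    ≈-trans (count-skip (PI 1) (1 + 3 * N) (PI-excluded 1 (2 + 3 * N) (cong (λ z → not (z ≡ᵇ 2)) (mod₃ 2))))
            (count-swapCount (PI 1) (3 * N) (PI-marked 1 (1 + 3 * N) (cong (λ z → not (z ≡ᵇ 2)) (mod₃ 1)) (cong (_≡ᵇ 1) (mod₃ 1))))
  lower-two (inj₂ refl) =
    ≈-trans (count-swapCount (PI 2) (1 + 3 * N) (PI-marked 2 (2 + 3 * N) (cong (λ z → not (z ≡ᵇ 1)) (mod₃ 2)) (cong (_≡ᵇ 2) (mod₃ 2))))
            (swapCountPart-cong (2 + 3 * N) (count-skip (PI 2) (3 * N) (PI-excluded 2 (1 + 3 * N) (cong (λ z → not (z ≡ᵇ 1)) (mod₃ 1)))))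

offsetG-origin : ∀ m → offsetG m 0 0 0 ≗ 𝟙
offsetG-origin m n = trans (cong (λ k → shift k (G 0 0 0) n) (offset-origin m)) (G-origin n)

DI-closedForm : ∀ m → m ≡ 1 ⊎ m ≡ 2 → ∀ N → count (PI m) (3 * N) ≈ closedForm m N
DI-closedForm m m∈ zero    zero    zero    zero    = sym (offsetG-origin m 0)
DI-closedForm m m∈ zero    zero    zero    (suc n) = sym (offsetG-origin m (suc n))
DI-closedForm m m∈ zero    zero    (suc j) zero    = refl
DI-closedForm m m∈ zero    zero    (suc j) (suc n) = refl
DI-closedForm m m∈ zero    (suc i) j       zero    = refl
DI-closedForm m m∈ zero    (suc i) j       (suc n) = refl
DI-closedForm m m∈ (suc N) =
  ≈-trans (DI-block m m∈ N)
    (≈-trans (swapPart-cong (3 + 3 * N) (swapCountPart-cong (m + 3 * N) (DI-closedForm m m∈ N)))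
             (≈-sym (closedForm-suc m N)))

-- condII m N i j is PII m N (N ∸ i) (N ∸ i ∸ j) i j.
PII : ℕ → ℕ → ℕ → ℕ → PFam
PII m A B Γ a b π =
  allB (notNegM m) π
  ∧ (countB (λ p → p % 6 ≡ᵇ m) π ≡ᵇ a)
  ∧ allB (λ p → if p % 6 ≡ᵇ m then p + 6 ≤ᵇ 6 * A + m else true) π
  ∧ (countB (λ p → p % 6 ≡ᵇ (m + 3)) π ≡ᵇ b)
  ∧ allB (λ p → if p % 6 ≡ᵇ (m + 3) then p + 3 ≤ᵇ 6 * B + m else true) π
  ∧ allB (λ p → if p % 3 ≡ᵇ 0 then p ≤ᵇ 3 * Γ else true) π

∧-false₅ : ∀ p q s t u → p ∧ (q ∧ (s ∧ (t ∧ (u ∧ false)))) ≡ false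
∧-false₅ p q s t u rewrite ∧-zeroʳ u | ∧-zeroʳ t | ∧-zeroʳ s | ∧-zeroʳ q | ∧-zeroʳ p = refl

∧-pull₆ : ∀ p q s t u f z → p ∧ (q ∧ (s ∧ (t ∧ (u ∧ (f ∧ z))))) ≡ f ∧ (p ∧ (q ∧ (s ∧ (t ∧ (u ∧ z)))))
∧-pull₆ p q s t u true  z = refl
∧-pull₆ p q s t u false z = ∧-false₅ p q s t u

∧-pull₃ : ∀ p q f s r → p ∧ (q ∧ ((f ∧ s) ∧ r)) ≡ f ∧ (p ∧ (q ∧ (s ∧ r)))
∧-pull₃ p q true  s r = refl
∧-pull₃ p q false s r rewrite ∧-zeroʳ q | ∧-zeroʳ p = refl

∧-pull₅ : ∀ p q s t f u z → p ∧ (q ∧ (s ∧ (t ∧ ((f ∧ u) ∧ z)))) ≡ f ∧ (p ∧ (q ∧ (s ∧ (t ∧ (u ∧ z)))))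
∧-pull₅ p q s t true  u z = refl
∧-pull₅ p q s t false u z rewrite ∧-zeroʳ t | ∧-zeroʳ s | ∧-zeroʳ q | ∧-zeroʳ p = refl

module _ (m A B Γ : ℕ) where

  private
    P = PII m A B Γ
    allowed : List ℕ → Bool
    allowed π = allB (notNegM m) π
    bounded₀ bounded₁ bounded₂ : List ℕ → Bool
    bounded₁ π = allB (λ p → if p % 6 ≡ᵇ m then p + 6 ≤ᵇ 6 * A + m else true) π
    bounded₂ π = allB (λ p → if p % 6 ≡ᵇ (m + 3) then p + 3 ≤ᵇ 6 * B + m else true) π
    bounded₀ π = allB (λ p → if p % 3 ≡ᵇ 0 then p ≤ᵇ 3 * Γ else true) π
    count₁ count₂ : List ℕ → ℕ
    count₁ π = countB (λ p → p % 6 ≡ᵇ m) π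
    count₂ π = countB (λ p → p % 6 ≡ᵇ (m + 3)) π

  PII-excluded : ∀ x → notNegM m x ≡ false → ∀ a b π → P a b (x ∷ π) ≡ false
  PII-excluded x excluded a b π rewrite excluded = refl

  PII-free : ∀ x → notNegM m x ≡ true → (x % 6 ≡ᵇ m) ≡ false → (x % 6 ≡ᵇ (m + 3)) ≡ false → (x % 3 ≡ᵇ 0) ≡ true →
    ∀ a b π → P a b (x ∷ π) ≡ (x ≤ᵇ 3 * Γ) ∧ P a b π
  PII-free x e₁ e₂ e₃ e₄ a b π rewrite e₁ | e₂ | e₃ | e₄ =
    ∧-pull₆ (allowed π) (count₁ π ≡ᵇ a) (bounded₁ π) (count₂ π ≡ᵇ b) (bounded₂ π) (x ≤ᵇ 3 * Γ) (bounded₀ π)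

  PII-tallyA : ∀ x → notNegM m x ≡ true → (x % 6 ≡ᵇ m) ≡ true → (x % 6 ≡ᵇ (m + 3)) ≡ false → (x % 3 ≡ᵇ 0) ≡ false →
    ∀ a b π → P a b (x ∷ π) ≡ (x + 6 ≤ᵇ 6 * A + m) ∧ onPred a (λ a′ → P a′ b π)
  PII-tallyA x e₁ e₂ e₃ e₄ zero b π rewrite e₁ | e₂ =
    trans (∧-zeroʳ (allowed π)) (sym (∧-zeroʳ (x + 6 ≤ᵇ 6 * A + m)))
  PII-tallyA x e₁ e₂ e₃ e₄ (suc a) b π rewrite e₁ | e₂ | e₃ | e₄ =
    ∧-pull₃ (allowed π) (count₁ π ≡ᵇ a) (x + 6 ≤ᵇ 6 * A + m) (bounded₁ π) ((count₂ π ≡ᵇ b) ∧ (bounded₂ π ∧ bounded₀ π))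

  PII-tallyB : ∀ x → notNegM m x ≡ true → (x % 6 ≡ᵇ m) ≡ false → (x % 6 ≡ᵇ (m + 3)) ≡ true → (x % 3 ≡ᵇ 0) ≡ false →
    ∀ a b π → P a b (x ∷ π) ≡ (x + 3 ≤ᵇ 6 * B + m) ∧ onPred b (λ b′ → P a b′ π)
  PII-tallyB x e₁ e₂ e₃ e₄ a zero π rewrite e₁ | e₂ | e₃ =
    trans (∧-false₅ (allowed π) (count₁ π ≡ᵇ a) (bounded₁ π) false false) (sym (∧-zeroʳ (x + 3 ≤ᵇ 6 * B + m)))
  PII-tallyB x e₁ e₂ e₃ e₄ a (suc b) π rewrite e₁ | e₂ | e₃ | e₄ =
    ∧-pull₅ (allowed π) (count₁ π ≡ᵇ a) (bounded₁ π) (count₂ π ≡ᵇ b) (x + 3 ≤ᵇ 6 * B + m) (bounded₂ π) (bounded₀ π)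

≤ᵇ-scale : ∀ c k x y .{{_ : NonZero k}} → (c + k * x ≤ᵇ c + k * y) ≡ (x ≤ᵇ y)
≤ᵇ-scale c k x y with x ≤? y
... | yes x≤y = trans (≤ᵇ-true (+-monoʳ-≤ c (*-monoʳ-≤ k x≤y))) (sym (≤ᵇ-true x≤y))
... | no  x≰y = trans (≤ᵇ-false (+-monoʳ-< c (*-monoʳ-< k (≰⇒> x≰y)))) (sym (≤ᵇ-false (≰⇒> x≰y)))

block-≡ : ∀ m L F {okA okA′ ok₃ ok₃′ okB okB′ ok₆ ok₆′} →
  okA ≡ okA′ → ok₃ ≡ ok₃′ → okB ≡ okB′ → ok₆ ≡ ok₆′ → block m L okA ok₃ okB ok₆ F ≡ block m L okA′ ok₃′ okB′ ok₆′ F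
block-≡ m L F refl refl refl refl = refl

module _ (L A B Γ : ℕ) where

  private
    mod₆ : ∀ s → (s + 6 * L) % 6 ≡ s % 6
    mod₆ s = trans (cong (λ k → (s + k) % 6) (*-comm 6 L)) ([m+kn]%n≡m%n s L 6)
    mod₃ : ∀ s → (s + 6 * L) % 3 ≡ s % 3
    mod₃ s = trans (cong (λ k → (s + k) % 3) (six L)) ([m+kn]%n≡m%n s (2 * L) 3)
      where
      six : ∀ L → 6 * L ≡ 2 * L * 3
      six = solve-∀
    allowedAt : ∀ m s → notNegM m (s + 6 * L) ≡ not (s % 3 ≡ᵇ (3 ∸ m))
    allowedAt m s = cong (λ z → not (z ≡ᵇ (3 ∸ m))) (mod₃ s)
    class₁At : ∀ m s → ((s + 6 * L) % 6 ≡ᵇ m) ≡ (s % 6 ≡ᵇ m)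
    class₁At m s = cong (_≡ᵇ m) (mod₆ s)
    class₂At : ∀ m s → ((s + 6 * L) % 6 ≡ᵇ (m + 3)) ≡ (s % 6 ≡ᵇ (m + 3))
    class₂At m s = cong (_≡ᵇ (m + 3)) (mod₆ s)
    class₀At : ∀ s → ((s + 6 * L) % 3 ≡ᵇ 0) ≡ (s % 3 ≡ᵇ 0)
    class₀At s = cong (_≡ᵇ 0) (mod₃ s)

    flagA : ∀ m → (m + 6 * L + 6 ≤ᵇ 6 * A + m) ≡ (suc L ≤ᵇ A)
    flagA m = trans (cong₂ _≤ᵇ_ (lemma m L) (+-comm (6 * A) m)) (≤ᵇ-scale m 6 (suc L) A)
      where
      lemma : ∀ m L → m + 6 * L + 6 ≡ m + 6 * suc L
      lemma = solve-∀
    flagB : ∀ m → (3 + m + 6 * L + 3 ≤ᵇ 6 * B + m) ≡ (suc L ≤ᵇ B)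
    flagB m = trans (cong₂ _≤ᵇ_ (lemma m L) (+-comm (6 * B) m)) (≤ᵇ-scale m 6 (suc L) B)
      where
      lemma : ∀ m L → 3 + m + 6 * L + 3 ≡ m + 6 * suc L
      lemma = solve-∀
    flag₃ : (3 + 6 * L ≤ᵇ 3 * Γ) ≡ (suc (2 * L) ≤ᵇ Γ)
    flag₃ = trans (cong (_≤ᵇ 3 * Γ) (lemma L)) (≤ᵇ-scale 0 3 (suc (2 * L)) Γ)
      where
      lemma : ∀ L → 3 + 6 * L ≡ 0 + 3 * suc (2 * L)
      lemma = solve-∀
    flag₆ : (6 + 6 * L ≤ᵇ 3 * Γ) ≡ (suc (suc (2 * L)) ≤ᵇ Γ)
    flag₆ = trans (cong (_≤ᵇ 3 * Γ) (lemma L)) (≤ᵇ-scale 0 3 (suc (suc (2 * L))) Γ)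
      where
      lemma : ∀ L → 6 + 6 * L ≡ 0 + 3 * suc (suc (2 * L))
      lemma = solve-∀

    free-at : ∀ m s → notNegM m (s + 6 * L) ≡ true → (s % 6 ≡ᵇ m) ≡ false → (s % 6 ≡ᵇ (m + 3)) ≡ false → (s % 3 ≡ᵇ 0) ≡ true →
      ∀ a b π → PII m A B Γ a b (s + 6 * L ∷ π) ≡ (s + 6 * L ≤ᵇ 3 * Γ) ∧ PII m A B Γ a b π
    free-at m s e₁ e₂ e₃ e₄ = PII-free m A B Γ (s + 6 * L) e₁ (trans (class₁At m s) e₂) (trans (class₂At m s) e₃) (trans (class₀At s) e₄)

  DII-block : ∀ m → m ≡ 1 ⊎ m ≡ 2 →
    count (PII m A B Γ) (6 * suc L) ≈
      block m L (suc L ≤ᵇ A) (suc (2 * L) ≤ᵇ Γ) (suc L ≤ᵇ B) (suc (suc (2 * L)) ≤ᵇ Γ) (count (PII m A B Γ) (6 * L))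
  DII-block .1 (inj₁ refl) = begin
    count P (6 * suc L)
      ≡⟨ cong (count P) (*-suc 6 L) ⟩
    count P (6 + 6 * L)
      ≈⟨ count-free P (5 + 6 * L) raw₆ (free-at 1 6 (allowedAt 1 6) refl refl refl) ⟩
    allow free raw₆ (6 + 6 * L) (count P (5 + 6 * L))
      ≈⟨ allow-cong free raw₆ (6 + 6 * L) (count-skip P (4 + 6 * L) (PII-excluded 1 A B Γ (5 + 6 * L) (allowedAt 1 5))) ⟩
    allow free raw₆ (6 + 6 * L) (count P (4 + 6 * L))
      ≈⟨ allow-cong free raw₆ (6 + 6 * L) (count-tallyB P (3 + 6 * L) (rawB 1) (PII-tallyB 1 A B Γ (4 + 6 * L) (allowedAt 1 4) (class₁At 1 4) (class₂At 1 4) (class₀At 4))) ⟩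
    allow free raw₆ (6 + 6 * L) (allow tallyB (rawB 1) (4 + 6 * L) (count P (3 + 6 * L)))
      ≈⟨ allow-cong free raw₆ (6 + 6 * L) (allow-cong tallyB (rawB 1) (4 + 6 * L) (count-free P (2 + 6 * L) raw₃ (free-at 1 3 (allowedAt 1 3) refl refl refl))) ⟩
    allow free raw₆ (6 + 6 * L) (allow tallyB (rawB 1) (4 + 6 * L) (allow free raw₃ (3 + 6 * L) (count P (2 + 6 * L))))
      ≈⟨ allow-cong free raw₆ (6 + 6 * L) (allow-cong tallyB (rawB 1) (4 + 6 * L) (allow-cong free raw₃ (3 + 6 * L)
           (≈-trans (count-skip P (1 + 6 * L) (PII-excluded 1 A B Γ (2 + 6 * L) (allowedAt 1 2)))
                    (count-tallyA P (6 * L) (rawA 1) (PII-tallyA 1 A B Γ (1 + 6 * L) (allowedAt 1 1) (class₁At 1 1) (class₂At 1 1) (class₀At 1)))))) ⟩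
    block 1 L (rawA 1) raw₃ (rawB 1) raw₆ (count P (6 * L))
      ≡⟨ block-≡ 1 L (count P (6 * L)) (flagA 1) flag₃ (flagB 1) flag₆ ⟩
    block 1 L (suc L ≤ᵇ A) (suc (2 * L) ≤ᵇ Γ) (suc L ≤ᵇ B) (suc (suc (2 * L)) ≤ᵇ Γ) (count P (6 * L))
      ∎
    where
    open ≈-Reasoning
    P = PII 1 A B Γ
    raw₆ = 6 + 6 * L ≤ᵇ 3 * Γ
    raw₃ = 3 + 6 * L ≤ᵇ 3 * Γ
    rawA rawB : ℕ → Bool
    rawA m = m + 6 * L + 6 ≤ᵇ 6 * A + m
    rawB m = 3 + m + 6 * L + 3 ≤ᵇ 6 * B + m
  DII-block .2 (inj₂ refl) = begin
    count P (6 * suc L)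
      ≡⟨ cong (count P) (*-suc 6 L) ⟩
    count P (6 + 6 * L)
      ≈⟨ count-free P (5 + 6 * L) raw₆ (free-at 2 6 (allowedAt 2 6) refl refl refl) ⟩
    allow free raw₆ (6 + 6 * L) (count P (5 + 6 * L))
      ≈⟨ allow-cong free raw₆ (6 + 6 * L) (count-tallyB P (4 + 6 * L) (rawB 2) (PII-tallyB 2 A B Γ (5 + 6 * L) (allowedAt 2 5) (class₁At 2 5) (class₂At 2 5) (class₀At 5))) ⟩
    allow free raw₆ (6 + 6 * L) (allow tallyB (rawB 2) (5 + 6 * L) (count P (4 + 6 * L)))
      ≈⟨ allow-cong free raw₆ (6 + 6 * L) (allow-cong tallyB (rawB 2) (5 + 6 * L)
           (≈-trans (count-skip P (3 + 6 * L) (PII-excluded 2 A B Γ (4 + 6 * L) (allowedAt 2 4)))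
                    (count-free P (2 + 6 * L) raw₃ (free-at 2 3 (allowedAt 2 3) refl refl refl)))) ⟩
    allow free raw₆ (6 + 6 * L) (allow tallyB (rawB 2) (5 + 6 * L) (allow free raw₃ (3 + 6 * L) (count P (2 + 6 * L))))
      ≈⟨ allow-cong free raw₆ (6 + 6 * L) (allow-cong tallyB (rawB 2) (5 + 6 * L) (allow-cong free raw₃ (3 + 6 * L)
           (≈-trans (count-tallyA P (1 + 6 * L) (rawA 2) (PII-tallyA 2 A B Γ (2 + 6 * L) (allowedAt 2 2) (class₁At 2 2) (class₂At 2 2) (class₀At 2)))
                    (allow-cong tallyA (rawA 2) (2 + 6 * L) (count-skip P (6 * L) (PII-excluded 2 A B Γ (1 + 6 * L) (allowedAt 2 1))))))) ⟩
    block 2 L (rawA 2) raw₃ (rawB 2) raw₆ (count P (6 * L))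
      ≡⟨ block-≡ 2 L (count P (6 * L)) (flagA 2) flag₃ (flagB 2) flag₆ ⟩
    block 2 L (suc L ≤ᵇ A) (suc (2 * L) ≤ᵇ Γ) (suc L ≤ᵇ B) (suc (suc (2 * L)) ≤ᵇ Γ) (count P (6 * L))
      ∎
    where
    open ≈-Reasoning
    P = PII 2 A B Γ
    raw₆ = 6 + 6 * L ≤ᵇ 3 * Γ
    raw₃ = 3 + 6 * L ≤ᵇ 3 * Γ
    rawA rawB : ℕ → Bool
    rawA m = m + 6 * L + 6 ≤ᵇ 6 * A + m
    rawB m = 3 + m + 6 * L + 3 ≤ᵇ 6 * B + m

DII-DIIgf : ∀ m → m ≡ 1 ⊎ m ≡ 2 → ∀ L A B Γ → count (PII m A B Γ) (6 * L) ≈ DIIgf m L A B Γ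
DII-DIIgf m m∈ zero    A B Γ zero    zero    zero    = refl
DII-DIIgf m m∈ zero    A B Γ zero    zero    (suc n) = refl
DII-DIIgf m m∈ zero    A B Γ zero    (suc b) zero    = refl
DII-DIIgf m m∈ zero    A B Γ zero    (suc b) (suc n) = refl
DII-DIIgf m m∈ zero    A B Γ (suc a) b       zero    = refl
DII-DIIgf m m∈ zero    A B Γ (suc a) b       (suc n) = refl
DII-DIIgf m m∈ (suc L) A B Γ =
  ≈-trans (DII-block L A B Γ m m∈)
          (block-cong m L (suc L ≤ᵇ A) (suc (2 * L) ≤ᵇ Γ) (suc L ≤ᵇ B) (suc (suc (2 * L)) ≤ᵇ Γ) (DII-DIIgf m m∈ L A B Γ))

DIIgf-closedForm : ∀ m L N i j → N ≤ L → DIIgf m L N (N ∸ i) (N ∸ i ∸ j) i j ≗ closedForm m N i j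
DIIgf-closedForm m L N i j N≤L n with i + j ≤? N
... | yes i+j≤N with m≤n⇒∃[o]m+o≡n i+j≤N
...   | r , refl = begin
  DIIgf m L (i + j + r) (i + j + r ∸ i) (i + j + r ∸ i ∸ j) i j n
    ≡⟨ cong₂ (λ B Γ → DIIgf m L (i + j + r) B Γ i j n) B≡ (trans (cong (_∸ j) B≡) (m+n∸m≡n j r)) ⟩
  DIIgf m L (i + j + r) (j + r) r i j n
    ≡⟨ DIIgf-closed m L i j r N≤L n ⟩
  offsetG m i j r n
    ≡⟨ sym (closedForm-at m (i + j + r) i j r refl n) ⟩
  closedForm m (i + j + r) i j n
    ∎
  where
  open ≡-Reasoning
  B≡ : i + j + r ∸ i ≡ j + r
  B≡ = trans (cong (_∸ i) (+-assoc i j r)) (m+n∸m≡n i (j + r))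
DIIgf-closedForm m L N i j N≤L n | no i+j≰N with i ≤? N
... | no  i≰N = trans (DIIgf-zeroAtA m L N (N ∸ i) (N ∸ i ∸ j) i (inj₂ (≰⇒> i≰N)) j n)
                      (sym (closedForm-above m N i j (≰⇒> i+j≰N) n))
... | yes i≤N = trans (DIIgf-zeroAtB m L N (N ∸ i) (N ∸ i ∸ j) j (inj₂ N∸i<j) i n)
                      (sym (closedForm-above m N i j (≰⇒> i+j≰N) n))
  where
  N∸i<j : N ∸ i < j
  N∸i<j = +-cancelʳ-< i (N ∸ i) j (subst₂ _<_ (sym (m∸n+n≡m i≤N)) (+-comm i j) (≰⇒> i+j≰N))

-- Partitions of n have parts ≤ n, so using parts up to 6(n + N) loses nothing, and n + N ≥ N as DIIgf-closed needs.
DII-closedForm : ∀ m → m ≡ 1 ⊎ m ≡ 2 → ∀ N i j n → DII m N i j n ≡ closedForm m N i j n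
DII-closedForm m m∈ N i j n = begin
  countL (P i j) (DistinctPartitions n)
    ≡⟨ sym (countL-dparts-large (P i j) (6 * L) n (≤-trans (m≤m+n n N) (m≤n*m L 6))) ⟩
  count P (6 * L) i j n
    ≡⟨ DII-DIIgf m m∈ L N (N ∸ i) (N ∸ i ∸ j) i j n ⟩
  DIIgf m L N (N ∸ i) (N ∸ i ∸ j) i j n
    ≡⟨ DIIgf-closedForm m L N i j (m≤n+m N n) n ⟩
  closedForm m N i j n
    ∎
  where
  open ≡-Reasoning
  L = n + N
  P = PII m N (N ∸ i) (N ∸ i ∸ j)

theorem3p13 : (m N i j n : ℕ) → (m ≡ 1 ⊎ m ≡ 2) → DI m N i j n ≡ DII m N i j n
theorem3p13 m N i j n m∈ = begin
  DI m N i j n                 ≡⟨ DI-count m N i j n ⟩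
  count (PI m) (3 * N) i j n   ≡⟨ DI-closedForm m m∈ N i j n ⟩
  closedForm m N i j n         ≡⟨ sym (DII-closedForm m m∈ N i j n) ⟩
  DII m N i j n                ∎
  where open ≡-Reasoning
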